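{- Let $(X,\mathcal{B})$ be an $\mathsf{SQS}(v)$ used as a distribution design for a combinatorial repairable threshold scheme, and let $B\in\mathcal{B}$ be the block of a player. Suppose every other player is available independently with probability $p$. Let $r_1=\binom{v-1}{2}/3$ and $r_2=(v-2)/2$. Then the expected number of available minimal repair sets for $B$ is \[E(p)=3(r_2-1)^2p^2+2(r_2-1)\bigl(3r_1^2-12r_1r_2+6r_1+11r_2^2-10r_2+2\bigr)p^3+(r_1-3r_2+2)^4p^4.\]
   Context: An $\mathsf{SQS}(v)$ is a $3$-$(v,4,1)$-design: a set system $(X,\mathcal{B})$ with $|X|=v$, all blocks of size $4$, every $3$-set of points in exactly one block; $r_1$ (resp. $r_2$) is the number of blocks containing any given point (resp. pair of points). Blocks correspond to players. A repair set for the player with block $B$ is a set of other blocks (players) whose union contains $B$; it is minimal if no proper subset is a repair set, and available if all its players are available. $E(p)$ is the expected number of available minimal repair sets.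
   Formalization: The availability probability p of the other players ranges only over the rationals in [0,1]. -}

module Defs where

open import Data.Bool using (Bool; true; false; if_then_else_)
open import Data.Nat as ℕ using (ℕ; zero; suc; _∸_)
open import Data.Nat.Combinatorics using (_C_)
open import Data.Integer as ℤ using (ℤ; +_)
open import Data.Rational as ℚ using (ℚ; 0ℚ; 1ℚ; _+_; _*_; _-_; _/_)
open import Data.Fin using (Fin; _≟_)
open import Data.Fin.Subset using (Subset; _∈_; _∉_; _⊆_; _⊂_; ⋃; ∣_∣; inside; outside)
open import Data.Fin.Subset.Properties using (_∈?_; _⊆?_; _⊂?_; anySubset?)
open import Data.List as List using (List; []; _∷_; _++_; map; filter; allFin; foldr)
open import Data.Vec using (_∷_; [])
open import Data.Product using (Σ; _×_; _,_)
open import Relation.Binary.PropositionalEquality using (_≡_)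
open import Relation.Nullary using (¬_; Dec; yes; no; does; _×-dec_; ¬?)

-- Steiner quadruple systems SQS(v) = 3-(v,4,1) designs.
-- Points are Fin v; the blocks are indexed by players Fin b.

record SQS (v : ℕ) : Set where
  field
    b       : ℕ
    block   : Fin b → Subset v
    blockSize : ∀ j → ∣ block j ∣ ≡ 4
    unique3 : ∀ (T : Subset v) → ∣ T ∣ ≡ 3 →
              Σ (Fin b) λ j → (T ⊆ block j) × (∀ k → T ⊆ block k → k ≡ j)

module _ {v : ℕ} (D : SQS v) where
  open SQS D

  unionOf : Subset b → Subset v
  unionOf R = ⋃ (map block (filter (_∈? R) (allFin b)))

  IsRepairSet : Fin b → Subset b → Set
  IsRepairSet i R = (i ∉ R) × (block i ⊆ unionOf R)

  IsMinimalRepairSet : Fin b → Subset b → Set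
  IsMinimalRepairSet i R =
    IsRepairSet i R × (∀ R′ → R′ ⊂ R → ¬ IsRepairSet i R′)

  isRepairSet? : ∀ i R → Dec (IsRepairSet i R)
  isRepairSet? i R = ¬? (i ∈? R) ×-dec (block i ⊆? unionOf R)

  isMinimalRepairSet? : ∀ i R → Dec (IsMinimalRepairSet i R)
  isMinimalRepairSet? i R with isRepairSet? i R
    | anySubset? (λ R′ → R′ ⊂? R ×-dec isRepairSet? i R′)
  ... | no ¬rep | _ = no λ { (rep , _) → ¬rep rep }
  ... | yes rep | yes (R′ , lt , rep′) = no λ { (_ , min) → min R′ lt rep′ }
  ... | yes rep | no none = yes (rep , λ R′ lt rep′ → none (R′ , lt , rep′))

allSubsets : (n : ℕ) → List (Subset n)
allSubsets zero    = [] ∷ []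
allSubsets (suc n) = map (inside ∷_) (allSubsets n) ++ map (outside ∷_) (allSubsets n)

sumℚ : List ℚ → ℚ
sumℚ = foldr _+_ 0ℚ

prodℚ : List ℚ → ℚ
prodℚ = foldr _*_ 1ℚ

_^ℚ_ : ℚ → ℕ → ℚ
x ^ℚ zero  = 1ℚ
x ^ℚ suc n = x * (x ^ℚ n)

ℕtoℚ : ℕ → ℚ
ℕtoℚ n = + n / 1

indicator : ∀ {P : Set} → Dec P → ℚ
indicator d = if does d then 1ℚ else 0ℚ

module _ {v : ℕ} (D : SQS v) (i : Fin (SQS.b D)) (p : ℚ) where
  open SQS D

  -- Probability of the outcome "exactly the players in S are available",
  -- where player i (whose share is to be repaired) is unavailable and every
  -- other player is available independently with probability p.
  outcomeProb : Subset b → ℚ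
  outcomeProb S = prodℚ (map factor (allFin b))
    where
    factor : Fin b → ℚ
    factor j with j ≟ i | j ∈? S
    ... | yes _ | yes _ = 0ℚ
    ... | yes _ | no  _ = 1ℚ
    ... | no  _ | yes _ = p
    ... | no  _ | no  _ = 1ℚ - p

  availableMinimalRepairSets : Subset b → ℚ
  availableMinimalRepairSets S =
    sumℚ (map (λ R → indicator (isMinimalRepairSet? D i R ×-dec R ⊆? S)) (allSubsets b))

  E : ℚ
  E = sumℚ (map (λ S → outcomeProb S * availableMinimalRepairSets S) (allSubsets b))

r₁ : ℕ → ℚ
r₁ v = + ((v ∸ 1) C 2) / 3

r₂ : ℕ → ℚ
r₂ v = (+ v ℤ.- + 2) / 2

formula : ℕ → ℚ → ℚ
formula v p =
  ℕtoℚ 3 * ((R2 - 1ℚ) ^ℚ 2) * (p ^ℚ 2)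
  + ℕtoℚ 2 * (R2 - 1ℚ)
      * (ℕtoℚ 3 * (R1 ^ℚ 2) - ℕtoℚ 12 * R1 * R2 + ℕtoℚ 6 * R1
         + ℕtoℚ 11 * (R2 ^ℚ 2) - ℕtoℚ 10 * R2 + ℕtoℚ 2)
      * (p ^ℚ 3)
  + ((R1 - ℕtoℚ 3 * R2 + ℕtoℚ 2) ^ℚ 4) * (p ^ℚ 4)
  where
  R1 = r₁ v
  R2 = r₂ v

module Submission where

-- Only the trace of each block on B matters. Expanding over outcomes, E(p) is the sum of p^|R| over the
-- minimal repair sets R, and R is a minimal repair set exactly when the traces of its blocks cover the
-- four points of B and each of them has a private point; in particular no two members share a trace.
-- Grouping the players by trace therefore turns E(p) into a sum over minimal covers T of B by distinct
-- traces of the products of n_t·p over t ∈ T, where n_t counts the players with trace t. In an SQS a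
-- block other than B meets B in at most two points, and double counting gives n_t = r₂ − 1 for
-- two-point traces and n_t = r₁ − 3r₂ + 2 for one-point traces. Expanding the finitely many covers
-- symbolically yields the polynomial.

open import Data.Bool using (Bool; true; false; if_then_else_; _∧_; _∨_; not; T)
import Data.Bool.Properties as BoolP
open import Data.Bool.ListAction using (and; or; any; all)
open import Data.Empty using (⊥-elim)
open import Data.Fin using (Fin; zero; suc; _≟_)
open import Data.Fin.Patterns using (0F; 1F; 2F; 3F)
import Data.Fin.Properties as FinP
open import Data.Fin.Subset using (Subset; ∣_∣; _∈_; _∉_; _⊆_; _⊂_; ⋃; inside; outside)
open import Data.Fin.Subset.Properties using (_∈?_; _⊆?_; x∈p∪q⁻; x∈p∪q⁺; ∉⊥)
import Data.Integer as ℤ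
import Data.Integer.Properties as ℤP
import Data.Integer.Solver
open import Data.List using (List; []; _∷_; _++_; [_]; map; filter; allFin)
import Data.List.Properties as ListP
open import Data.List.Membership.Propositional using (lose) renaming (_∈_ to _∈ₗ_)
open import Data.List.Membership.Propositional.Properties
  using (∈-++⁺ˡ; ∈-++⁺ʳ; ∈-allFin; ∈-map⁺; ∈-map⁻; ∈-filter⁺; ∈-filter⁻)
import Data.List.Relation.Unary.All as All
open import Data.List.Relation.Unary.All.Properties using (all⁺; all⁻)
open import Data.List.Relation.Unary.AllPairs using (_∷_)
open import Data.List.Relation.Unary.Any using (here; there; satisfied)
open import Data.List.Relation.Unary.Any.Properties using (any⁺; any⁻)
open import Data.List.Relation.Unary.Unique.Propositional using (Unique)
import Data.List.Relation.Unary.Unique.DecPropositional as UniqueDec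
open import Data.Maybe using (Maybe; just; nothing)
import Data.Maybe.Properties as MaybeP
open import Data.Nat as ℕ using (ℕ; zero; suc; _≡ᵇ_; _≤ᵇ_; z≤n; s≤s)
open import Data.Nat.Combinatorics using (_C_; nCk+nC[k+1]≡[n+1]C[k+1]; nC1≡n)
import Data.Nat.Properties as ℕP
open import Algebra.Properties.Semiring.Sum ℕP.+-*-semiring
  using (sum; sum-cong-≗; ∑-distrib-+; ∑-comm; *-distribˡ-sum)
import Data.Nat.Solver
open import Data.Product using (Σ; _×_; _,_; proj₁; proj₂)
open import Data.Rational using (ℚ; 0ℚ; 1ℚ; toℚᵘ)
import Data.Rational.Properties as ℚP
import Data.Rational.Solver
open import Data.Rational.Unnormalised as ℚᵘ using (mkℚᵘ; *≡*)
import Data.Rational.Unnormalised.Properties as ℚᵘP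
open import Data.Sum using (_⊎_; inj₁; inj₂)
open import Data.Vec as Vec using (Vec; []; _∷_; tabulate; lookup; _[_]≔_)
import Data.Vec.Properties as VecP
open import Function using (_∘_)
open import Function.Bundles using (Equivalence)
open import Relation.Binary.Definitions using (DecidableEquality)
open import Relation.Binary.PropositionalEquality hiding ([_])
open import Relation.Nullary using (¬_; Dec; does; yes; no; _×-dec_)
open import Relation.Nullary.Decidable using (dec-true; dec-false; toWitness)
open import Defs

module ℚS = Data.Rational.Solver.+-*-Solver
module ℤS = Data.Integer.Solver.+-*-Solver

module Expectation where
  open import Data.Rational using (_+_; _*_; _-_)
  open ℚS using (solve; con; _:+_; _:*_; _:-_; _:=_)

  sumℚ-++ : ∀ xs ys → sumℚ (xs ++ ys) ≡ sumℚ xs + sumℚ ys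
  sumℚ-++ []       ys = sym (ℚP.+-identityˡ _)
  sumℚ-++ (x ∷ xs) ys = trans (cong (x +_) (sumℚ-++ xs ys)) (sym (ℚP.+-assoc x _ _))

  sumℚ-*ˡ : ∀ {A : Set} c (f : A → ℚ) xs → sumℚ (map (λ a → c * f a) xs) ≡ c * sumℚ (map f xs)
  sumℚ-*ˡ c f []       = sym (ℚP.*-zeroʳ c)
  sumℚ-*ˡ c f (x ∷ xs) = trans (cong (c * f x +_) (sumℚ-*ˡ c f xs)) (sym (ℚP.*-distribˡ-+ c _ _))

  sumℚ-+ : ∀ {A : Set} (f g : A → ℚ) xs →
           sumℚ (map (λ a → f a + g a) xs) ≡ sumℚ (map f xs) + sumℚ (map g xs)
  sumℚ-+ f g []       = refl
  sumℚ-+ f g (x ∷ xs) = trans (cong (f x + g x +_) (sumℚ-+ f g xs)) (interchange (f x) (g x) _ _)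
    where
    interchange : ∀ a b c d → a + b + (c + d) ≡ a + c + (b + d)
    interchange = solve 4 (λ a b c d → a :+ b :+ (c :+ d) := a :+ c :+ (b :+ d)) refl

  sumℚ-comm : ∀ {A B : Set} (h : A → B → ℚ) xs ys →
              sumℚ (map (λ a → sumℚ (map (h a) ys)) xs) ≡ sumℚ (map (λ b → sumℚ (map (λ a → h a b) xs)) ys)
  sumℚ-comm h []       ys = sym (sumℚ-zero ys)
    where
    sumℚ-zero : ∀ {B : Set} (ys : List B) → sumℚ (map (λ _ → 0ℚ) ys) ≡ 0ℚ
    sumℚ-zero []       = refl
    sumℚ-zero (y ∷ ys) = trans (ℚP.+-identityˡ _) (sumℚ-zero ys)
  sumℚ-comm h (x ∷ xs) ys =
    trans (cong (sumℚ (map (h x) ys) +_) (sumℚ-comm h xs ys)) (sym (sumℚ-+ (h x) _ ys))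

  map-allFin-suc : ∀ {A : Set} {n} (g : Fin (suc n) → A) →
                   map g (allFin (suc n)) ≡ g zero ∷ map (g ∘ suc) (allFin n)
  map-allFin-suc g = cong (g zero ∷_) (trans (ListP.map-tabulate suc g) (sym (ListP.map-tabulate (λ j → j) (g ∘ suc))))

  sumℚ-allSubsets-suc : ∀ n (f : Subset (suc n) → ℚ) →
    sumℚ (map f (allSubsets (suc n))) ≡
    sumℚ (map (f ∘ (true ∷_)) (allSubsets n)) + sumℚ (map (f ∘ (false ∷_)) (allSubsets n))
  sumℚ-allSubsets-suc n f = begin
    sumℚ (map f (map (true ∷_) S ++ map (false ∷_) S))
      ≡⟨ cong sumℚ (ListP.map-++ f (map (true ∷_) S) _) ⟩
    sumℚ (map f (map (true ∷_) S) ++ map f (map (false ∷_) S))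
      ≡⟨ sumℚ-++ (map f (map (true ∷_) S)) _ ⟩
    sumℚ (map f (map (true ∷_) S)) + sumℚ (map f (map (false ∷_) S))
      ≡⟨ sym (cong₂ _+_ (cong sumℚ (ListP.map-∘ S)) (cong sumℚ (ListP.map-∘ S))) ⟩
    sumℚ (map (f ∘ (true ∷_)) S) + sumℚ (map (f ∘ (false ∷_)) S) ∎
    where
    open ≡-Reasoning
    S = allSubsets n

  ∈-allSubsets : ∀ {n} (S : Subset n) → S ∈ₗ allSubsets n
  ∈-allSubsets []          = here refl
  ∈-allSubsets {suc n} (true ∷ S)  = ∈-++⁺ˡ (∈-map⁺ (true ∷_) (∈-allSubsets S))
  ∈-allSubsets {suc n} (false ∷ S) = ∈-++⁺ʳ (map (true ∷_) (allSubsets n)) (∈-map⁺ (false ∷_) (∈-allSubsets S))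

  module _ {n : ℕ} where

    weight : (Fin n → Bool → ℚ) → Subset n → ℚ
    weight w S = prodℚ (map (λ j → w j (does (j ∈? S))) (allFin n))

    upwardFactor : (Fin n → Bool → ℚ) → Subset n → Fin n → ℚ
    upwardFactor w R j = if does (j ∈? R) then w j true else w j true + w j false

    upwardMass : (Fin n → Bool → ℚ) → Subset n → ℚ
    upwardMass w R = prodℚ (map (upwardFactor w R) (allFin n))

    _^∣_∣ : ℚ → Subset n → ℚ
    p ^∣ R ∣ = prodℚ (map (λ j → if does (j ∈? R) then p else 1ℚ) (allFin n))

  sum-weight-⊇ : ∀ {n} (w : Fin n → Bool → ℚ) R →
    sumℚ (map (λ S → weight w S * indicator (R ⊆? S)) (allSubsets n)) ≡ upwardMass w R
  sum-weight-⊇ {zero}  w [] = trans (ℚP.+-identityʳ _) (ℚP.*-identityˡ _)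
  sum-weight-⊇ {suc n} w (r ∷ R) =
    trans (sumℚ-allSubsets-suc n (λ S → weight w S * indicator ((r ∷ R) ⊆? S))) (split r)
    where
    open ≡-Reasoning
    S = allSubsets n
    w′ = w ∘ suc
    rest : Subset n → ℚ
    rest S = weight w′ S * indicator (R ⊆? S)
    restMass : sumℚ (map rest S) ≡ upwardMass w′ R
    restMass = sum-weight-⊇ w′ R
    peel : ∀ s S → weight w (s ∷ S) ≡ w zero s * weight w′ S
    peel true  S = cong prodℚ (map-allFin-suc (λ j → w j (does (j ∈? (true ∷ S)))))
    peel false S = cong prodℚ (map-allFin-suc (λ j → w j (does (j ∈? (false ∷ S)))))
    peelMass : ∀ r → upwardMass w (r ∷ R) ≡ (if r then w zero true else w zero true + w zero false) * upwardMass w′ R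
    peelMass true  = cong prodℚ (map-allFin-suc (upwardFactor w (true ∷ R)))
    peelMass false = cong prodℚ (map-allFin-suc (upwardFactor w (false ∷ R)))
    kept : ∀ s S → weight w (s ∷ S) * indicator (R ⊆? S) ≡ w zero s * rest S
    kept s S = trans (cong (_* _) (peel s S)) (ℚP.*-assoc (w zero s) _ _)
    split : ∀ r → sumℚ (map (λ S → weight w (true ∷ S) * indicator ((r ∷ R) ⊆? (true ∷ S))) S)
                + sumℚ (map (λ S → weight w (false ∷ S) * indicator ((r ∷ R) ⊆? (false ∷ S))) S)
                ≡ upwardMass w (r ∷ R)
    split true = begin
      sumℚ (map (λ S → weight w (true ∷ S) * indicator (R ⊆? S)) S)
        + sumℚ (map (λ S → weight w (false ∷ S) * 0ℚ) S)
        ≡⟨ cong₂ _+_ (cong sumℚ (ListP.map-cong (kept true) S))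
                     (cong sumℚ (ListP.map-cong (λ S → trans (ℚP.*-zeroʳ (weight w (false ∷ S))) (sym (ℚP.*-zeroˡ (rest S)))) S)) ⟩
      sumℚ (map (λ S → w zero true * rest S) S) + sumℚ (map (λ S → 0ℚ * rest S) S)
        ≡⟨ cong₂ _+_ (sumℚ-*ˡ (w zero true) rest S) (sumℚ-*ˡ 0ℚ rest S) ⟩
      w zero true * sumℚ (map rest S) + 0ℚ * sumℚ (map rest S)
        ≡⟨ cong₂ (λ a b → w zero true * a + 0ℚ * b) restMass restMass ⟩
      w zero true * upwardMass w′ R + 0ℚ * upwardMass w′ R
        ≡⟨ trans (cong (w zero true * upwardMass w′ R +_) (ℚP.*-zeroˡ (upwardMass w′ R))) (ℚP.+-identityʳ _) ⟩
      w zero true * upwardMass w′ R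
        ≡⟨ sym (peelMass true) ⟩
      upwardMass w (true ∷ R) ∎
    split false = begin
      sumℚ (map (λ S → weight w (true ∷ S) * indicator (R ⊆? S)) S)
        + sumℚ (map (λ S → weight w (false ∷ S) * indicator (R ⊆? S)) S)
        ≡⟨ cong₂ _+_ (cong sumℚ (ListP.map-cong (kept true) S)) (cong sumℚ (ListP.map-cong (kept false) S)) ⟩
      sumℚ (map (λ S → w zero true * rest S) S) + sumℚ (map (λ S → w zero false * rest S) S)
        ≡⟨ cong₂ _+_ (sumℚ-*ˡ (w zero true) rest S) (sumℚ-*ˡ (w zero false) rest S) ⟩
      w zero true * sumℚ (map rest S) + w zero false * sumℚ (map rest S)
        ≡⟨ sym (ℚP.*-distribʳ-+ _ (w zero true) (w zero false)) ⟩
      (w zero true + w zero false) * sumℚ (map rest S)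
        ≡⟨ cong ((w zero true + w zero false) *_) restMass ⟩
      (w zero true + w zero false) * upwardMass w′ R
        ≡⟨ sym (peelMass false) ⟩
      upwardMass w (false ∷ R) ∎

  indicator-× : ∀ {P Q : Set} (P? : Dec P) (Q? : Dec Q) → indicator (P? ×-dec Q?) ≡ indicator P? * indicator Q?
  indicator-× (yes _) (yes _) = refl
  indicator-× (yes _) (no _)  = refl
  indicator-× (no _)  (yes _) = refl
  indicator-× (no _)  (no _)  = refl

  module _ {v : ℕ} (D : SQS v) (i : Fin (SQS.b D)) (p : ℚ) where
    open SQS D

    availability : Fin b → Bool → ℚ
    availability j s = if does (j ≟ i) then (if s then 0ℚ else 1ℚ) else (if s then p else 1ℚ - p)

    -- The left-hand side is the local factor of outcomeProb, which has no name; its use below fixes it.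
    outcomeFactor≡availability : ∀ S j → _ ≡ availability j (does (j ∈? S))

    outcomeProb≡weight : ∀ S → outcomeProb D i p S ≡ weight availability S
    outcomeProb≡weight S = cong prodℚ (ListP.map-cong (outcomeFactor≡availability S) (allFin b))

    outcomeFactor≡availability S j with j ≟ i | j ∈? S
    ... | yes _ | yes _ = refl
    ... | yes _ | no  _ = refl
    ... | no  _ | yes _ = refl
    ... | no  _ | no  _ = refl

    upwardMass-availability : ∀ R → i ∉ R → upwardMass availability R ≡ p ^∣ R ∣
    upwardMass-availability R i∉R = cong prodℚ (ListP.map-cong factor (allFin b))
      where
      factor : ∀ j → upwardFactor availability R j ≡ (if does (j ∈? R) then p else 1ℚ)
      factor j with j ≟ i
      ... | yes refl rewrite dec-false (i ∈? R) i∉R = refl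
      ... | no  _ with does (j ∈? R)
      ...   | true  = refl
      ...   | false = solve 1 (λ p → p :+ (con 1ℚ :- p) := con 1ℚ) refl p

    E≡sum-minimal : E D i p ≡ sumℚ (map (λ R → indicator (isMinimalRepairSet? D i R) * p ^∣ R ∣) (allSubsets b))
    E≡sum-minimal = begin
      E D i p
        ≡⟨ cong sumℚ (ListP.map-cong (λ S → cong₂ _*_ (outcomeProb≡weight S)
             (cong sumℚ (ListP.map-cong (λ R → indicator-× (isMinimalRepairSet? D i R) (R ⊆? S)) 𝒮))) 𝒮) ⟩
      sumℚ (map (λ S → weight availability S * sumℚ (map (λ R → min R * indicator (R ⊆? S)) 𝒮)) 𝒮)
        ≡⟨ cong sumℚ (ListP.map-cong (λ S → sym (sumℚ-*ˡ (weight availability S) _ 𝒮)) 𝒮) ⟩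
      sumℚ (map (λ S → sumℚ (map (λ R → weight availability S * (min R * indicator (R ⊆? S))) 𝒮)) 𝒮)
        ≡⟨ sumℚ-comm (λ S R → weight availability S * (min R * indicator (R ⊆? S))) 𝒮 𝒮 ⟩
      sumℚ (map (λ R → sumℚ (map (λ S → weight availability S * (min R * indicator (R ⊆? S))) 𝒮)) 𝒮)
        ≡⟨ cong sumℚ (ListP.map-cong perMinimal 𝒮) ⟩
      sumℚ (map (λ R → min R * p ^∣ R ∣) 𝒮) ∎
      where
      open ≡-Reasoning
      𝒮 = allSubsets b
      min : Subset b → ℚ
      min R = indicator (isMinimalRepairSet? D i R)
      perMinimal : ∀ R → sumℚ (map (λ S → weight availability S * (min R * indicator (R ⊆? S))) 𝒮) ≡ min R * p ^∣ R ∣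
      perMinimal R = begin
        sumℚ (map (λ S → weight availability S * (min R * indicator (R ⊆? S))) 𝒮)
          ≡⟨ cong sumℚ (ListP.map-cong (λ S → rotate (weight availability S) (min R) _) 𝒮) ⟩
        sumℚ (map (λ S → min R * (weight availability S * indicator (R ⊆? S))) 𝒮)
          ≡⟨ sumℚ-*ˡ (min R) _ 𝒮 ⟩
        min R * sumℚ (map (λ S → weight availability S * indicator (R ⊆? S)) 𝒮)
          ≡⟨ cong (min R *_) (sum-weight-⊇ availability R) ⟩
        min R * upwardMass availability R
          ≡⟨ onMinimal (isMinimalRepairSet? D i R) ⟩
        min R * p ^∣ R ∣ ∎
        where
        rotate : ∀ a b c → a * (b * c) ≡ b * (a * c)
        rotate = solve 3 (λ a b c → a :* (b :* c) := b :* (a :* c)) refl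
        onMinimal : (m : Dec (IsMinimalRepairSet D i R)) →
                    indicator m * upwardMass availability R ≡ indicator m * p ^∣ R ∣
        onMinimal (yes ((i∉R , _) , _)) = cong (1ℚ *_) (upwardMass-availability R i∉R)
        onMinimal (no _) = trans (ℚP.*-zeroˡ (upwardMass availability R)) (sym (ℚP.*-zeroˡ (p ^∣ R ∣)))

open Expectation

module Sublists where
  open import Data.Rational using (_+_; _*_)
  open ℚS using (solve; con; _:+_; _:*_; _:=_)
  open ℤ using (+_)

  ℕtoℚ-+ : ∀ m n → ℕtoℚ (m ℕ.+ n) ≡ ℕtoℚ m + ℕtoℚ n
  ℕtoℚ-+ m n = ℚP.toℚᵘ-injective (begin
    toℚᵘ (ℕtoℚ (m ℕ.+ n))               ≈⟨ ℚP.toℚᵘ-fromℚᵘ (mkℚᵘ (+ (m ℕ.+ n)) 0) ⟩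
    mkℚᵘ (+ (m ℕ.+ n)) 0                 ≈⟨ *≡* (ℤS.solve 2 (λ a c → (a ℤS.:+ c) ℤS.:* (ℤS.con (+ 1) ℤS.:* ℤS.con (+ 1))
                                                ℤS.:= (a ℤS.:* ℤS.con (+ 1) ℤS.:+ c ℤS.:* ℤS.con (+ 1)) ℤS.:* ℤS.con (+ 1))
                                                refl (+ m) (+ n)) ⟩
    mkℚᵘ (+ m) 0 ℚᵘ.+ mkℚᵘ (+ n) 0      ≈⟨ ℚᵘP.+-cong (ℚᵘP.≃-sym (ℚP.toℚᵘ-fromℚᵘ (mkℚᵘ (+ m) 0)))
                                                       (ℚᵘP.≃-sym (ℚP.toℚᵘ-fromℚᵘ (mkℚᵘ (+ n) 0))) ⟩
    toℚᵘ (ℕtoℚ m) ℚᵘ.+ toℚᵘ (ℕtoℚ n)    ≈⟨ ℚᵘP.≃-sym (ℚP.toℚᵘ-homo-+ (ℕtoℚ m) (ℕtoℚ n)) ⟩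
    toℚᵘ (ℕtoℚ m + ℕtoℚ n)              ∎)
    where open ℚᵘP.≃-Reasoning

  module _ {T : Set} (_≟_ : DecidableEquality T) where

    multiplicity : List T → T → ℕ
    multiplicity []      s = 0
    multiplicity (t ∷ L) s = if does (s ≟ t) then suc (multiplicity L s) else multiplicity L s

  module _ {T : Set} (F : List T → ℚ) where

    -- sublistSum w L ρ is the sum, over the sublists σ of L, of (∏ over t ∈ σ of w t) · F (ρ ++ σ).
    sublistSum : (T → ℚ) → List T → List T → ℚ
    sublistSum w []      ρ = F ρ
    sublistSum w (t ∷ L) ρ = sublistSum w L ρ + w t * sublistSum w L (ρ ++ [ t ])

    sublistSum-vanish : ∀ w ts α → (∀ γ → F (α ++ γ) ≡ 0ℚ) → sublistSum w ts α ≡ 0ℚ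
    sublistSum-vanish w []       α h = trans (cong F (sym (ListP.++-identityʳ α))) (h [])
    sublistSum-vanish w (s ∷ ts) α h = begin
      sublistSum w ts α + w s * sublistSum w ts (α ++ [ s ])
        ≡⟨ cong₂ (λ a b → a + w s * b) (sublistSum-vanish w ts α h)
             (sublistSum-vanish w ts (α ++ [ s ]) (λ γ → trans (cong F (ListP.++-assoc α [ s ] γ)) (h (s ∷ γ)))) ⟩
      0ℚ + w s * 0ℚ
        ≡⟨ trans (ℚP.+-identityˡ _) (ℚP.*-zeroʳ (w s)) ⟩
      0ℚ ∎
      where open ≡-Reasoning

    sublistSum-cong-prefix : ∀ w ts α β → (∀ γ → F (α ++ γ) ≡ F (β ++ γ)) →
                             sublistSum w ts α ≡ sublistSum w ts β
    sublistSum-cong-prefix w []       α β h =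
      trans (cong F (sym (ListP.++-identityʳ α))) (trans (h []) (cong F (ListP.++-identityʳ β)))
    sublistSum-cong-prefix w (s ∷ ts) α β h =
      cong₂ (λ a b → a + w s * b) (sublistSum-cong-prefix w ts α β h)
        (sublistSum-cong-prefix w ts (α ++ [ s ]) (β ++ [ s ]) (λ γ →
          trans (cong F (ListP.++-assoc α [ s ] γ)) (trans (h (s ∷ γ)) (cong F (sym (ListP.++-assoc β [ s ] γ))))))

    sublistSum-cong-weight : ∀ w w′ ts ρ →
      (∀ s → s ∈ₗ ts → w s ≡ w′ s ⊎ (∀ α γ → F (α ++ s ∷ γ) ≡ 0ℚ)) →
      sublistSum w ts ρ ≡ sublistSum w′ ts ρ
    sublistSum-cong-weight w w′ []       ρ h = refl
    sublistSum-cong-weight w w′ (s ∷ ts) ρ h with h s (here refl)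
    ... | inj₁ ws≡w′s = cong₂ _+_ (IH ρ) (cong₂ _*_ ws≡w′s (IH (ρ ++ [ s ])))
      where IH = λ ρ → sublistSum-cong-weight w w′ ts ρ (λ s′ → h s′ ∘ there)
    ... | inj₂ dead = cong₂ _+_ (sublistSum-cong-weight w w′ ts ρ (λ s′ → h s′ ∘ there))
                        (trans (cong (w s *_) (vanish w)) (trans (ℚP.*-zeroʳ (w s))
                          (sym (trans (cong (w′ s *_) (vanish w′)) (ℚP.*-zeroʳ (w′ s))))))
      where
      vanish : ∀ u → sublistSum u ts (ρ ++ [ s ]) ≡ 0ℚ
      vanish u = sublistSum-vanish u ts (ρ ++ [ s ]) (λ γ → trans (cong F (ListP.++-assoc ρ [ s ] γ)) (dead ρ γ))

    appended-twice : ∀ (ρ : List T) s t γ → ((ρ ++ [ s ]) ++ [ t ]) ++ γ ≡ ρ ++ s ∷ t ∷ γ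
    appended-twice ρ s t γ = trans (ListP.++-assoc (ρ ++ [ s ]) [ t ] γ) (ListP.++-assoc ρ [ s ] (t ∷ γ))

    sublistSum-zero : ∀ w ts ρ → (∀ s → w s ≡ 0ℚ) → sublistSum w ts ρ ≡ F ρ
    sublistSum-zero w []       ρ h = refl
    sublistSum-zero w (s ∷ ts) ρ h = trans (cong₂ (λ a c → a + c * sublistSum w ts (ρ ++ [ s ])) (sublistSum-zero w ts ρ h) (h s))
      (trans (cong (λ z → F ρ + z) (ℚP.*-zeroˡ (sublistSum w ts (ρ ++ [ s ])))) (ℚP.+-identityʳ (F ρ)))

    SwapInvariant : Set
    SwapInvariant = ∀ ρ s t γ → F (ρ ++ s ∷ t ∷ γ) ≡ F (ρ ++ t ∷ s ∷ γ)

    VanishesOnRepeats : Set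
    VanishesOnRepeats = ∀ ρ t γ → F (ρ ++ t ∷ t ∷ γ) ≡ 0ℚ

    module _ (swap : SwapInvariant) (repeats : VanishesOnRepeats) where

      sublistSum-insert : ∀ p w w′ ts → Unique ts → ∀ t → t ∈ₗ ts →
        w′ t ≡ w t + p → (∀ s → s ≢ t → w′ s ≡ w s) →
        ∀ ρ → sublistSum w′ ts ρ ≡ sublistSum w ts ρ + p * sublistSum w ts (ρ ++ [ t ])
      sublistSum-insert p w w′ (s ∷ ts) (s∉ts ∷ _) .s (here refl) w′s w′-other ρ = begin
        sublistSum w′ ts ρ + w′ s * sublistSum w′ ts (ρ ++ [ s ])
          ≡⟨ cong₂ _+_ (same ρ) (cong₂ _*_ w′s (same (ρ ++ [ s ]))) ⟩
        E₀ + (w s + p) * E₁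
          ≡⟨ distribute E₀ E₁ (w s) p ⟩
        E₀ + w s * E₁ + p * (E₁ + w s * 0ℚ)
          ≡⟨ cong (λ z → E₀ + w s * E₁ + p * (E₁ + w s * z)) (sym twice) ⟩
        E₀ + w s * E₁ + p * (E₁ + w s * sublistSum w ts ((ρ ++ [ s ]) ++ [ s ])) ∎
        where
        open ≡-Reasoning
        E₀ = sublistSum w ts ρ
        E₁ = sublistSum w ts (ρ ++ [ s ])
        same : ∀ α → sublistSum w′ ts α ≡ sublistSum w ts α
        same α = sublistSum-cong-weight w′ w ts α (λ u u∈ts → inj₁ (w′-other u λ { refl → All.lookup s∉ts u∈ts refl }))
        twice : sublistSum w ts ((ρ ++ [ s ]) ++ [ s ]) ≡ 0ℚ
        twice = sublistSum-vanish w ts ((ρ ++ [ s ]) ++ [ s ]) (λ γ → trans (cong F (appended-twice ρ s s γ)) (repeats ρ s γ))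
        distribute : ∀ e₀ e₁ c p → e₀ + (c + p) * e₁ ≡ e₀ + c * e₁ + p * (e₁ + c * 0ℚ)
        distribute = solve 4 (λ e₀ e₁ c p → e₀ :+ (c :+ p) :* e₁ := e₀ :+ c :* e₁ :+ p :* (e₁ :+ c :* con 0ℚ)) refl
      sublistSum-insert p w w′ (s ∷ ts) (s∉ts ∷ u) t (there t∈ts) w′t w′-other ρ = begin
        sublistSum w′ ts ρ + w′ s * sublistSum w′ ts (ρ ++ [ s ])
          ≡⟨ cong₂ _+_ (IH ρ) (cong₂ _*_ (w′-other s s≢t) (IH (ρ ++ [ s ]))) ⟩
        E₀ + p * F₀ + w s * (E₁ + p * F₁)
          ≡⟨ regroup E₀ F₀ E₁ F₁ (w s) p ⟩
        E₀ + w s * E₁ + p * (F₀ + w s * F₁)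
          ≡⟨ cong (λ z → E₀ + w s * E₁ + p * (F₀ + w s * z)) exchange ⟩
        E₀ + w s * E₁ + p * (F₀ + w s * sublistSum w ts ((ρ ++ [ t ]) ++ [ s ])) ∎
        where
        open ≡-Reasoning
        IH = sublistSum-insert p w w′ ts u t t∈ts w′t w′-other
        E₀ = sublistSum w ts ρ
        F₀ = sublistSum w ts (ρ ++ [ t ])
        E₁ = sublistSum w ts (ρ ++ [ s ])
        F₁ = sublistSum w ts ((ρ ++ [ s ]) ++ [ t ])
        s≢t : s ≢ t
        s≢t = All.lookup s∉ts t∈ts
        exchange : F₁ ≡ sublistSum w ts ((ρ ++ [ t ]) ++ [ s ])
        exchange = sublistSum-cong-prefix w ts ((ρ ++ [ s ]) ++ [ t ]) ((ρ ++ [ t ]) ++ [ s ]) (λ γ →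
          trans (cong F (appended-twice ρ s t γ)) (trans (swap ρ s t γ) (cong F (sym (appended-twice ρ t s γ)))))
        regroup : ∀ e₀ f₀ e₁ f₁ c p → e₀ + p * f₀ + c * (e₁ + p * f₁) ≡ e₀ + c * e₁ + p * (f₀ + c * f₁)
        regroup = solve 6 (λ e₀ f₀ e₁ f₁ c p →
          e₀ :+ p :* f₀ :+ c :* (e₁ :+ p :* f₁) := e₀ :+ c :* e₁ :+ p :* (f₀ :+ c :* f₁)) refl

      module _ (_≟_ : DecidableEquality T) where

        -- When F only sees the set of entries and kills repeats, a sublist of L is determined by a set of
        -- distinct values t, each of which can be picked in multiplicity L t ways.
        sublistSum-group : ∀ ts → Unique ts → (∀ t → t ∈ₗ ts) → ∀ p L ρ →
          sublistSum (λ _ → p) L ρ ≡ sublistSum (λ s → ℕtoℚ (multiplicity _≟_ L s) * p) ts ρ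
        sublistSum-group ts unique complete p [] ρ =
          sym (sublistSum-zero (λ s → ℕtoℚ 0 * p) ts ρ (λ _ → ℚP.*-zeroˡ p))
        sublistSum-group ts unique complete p (t ∷ L) ρ =
          trans (cong₂ (λ a b → a + p * b) (IH ρ) (IH (ρ ++ [ t ])))
            (sym (sublistSum-insert p w w′ ts unique t (complete t) w′t w′-other ρ))
          where
          IH = sublistSum-group ts unique complete p L
          w w′ : T → ℚ
          w  s = ℕtoℚ (multiplicity _≟_ L s) * p
          w′ s = ℕtoℚ (multiplicity _≟_ (t ∷ L) s) * p
          w′t : w′ t ≡ w t + p
          w′t with t ≟ t
          ... | yes _ = trans (cong (_* p) (ℕtoℚ-+ 1 (multiplicity _≟_ L t)))
                          (solve 2 (λ m p → (con 1ℚ :+ m) :* p := m :* p :+ p) refl (ℕtoℚ (multiplicity _≟_ L t)) p)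
          ... | no t≢t = ⊥-elim (t≢t refl)
          w′-other : ∀ s → s ≢ t → w′ s ≡ w s
          w′-other s s≢t with s ≟ t
          ... | yes s≡t = ⊥-elim (s≢t s≡t)
          ... | no _ = refl

  select : ∀ {A : Set} {n} → (Fin n → A) → Subset n → List A
  select {n = zero}  τ []          = []
  select {n = suc n} τ (true ∷ R)  = τ zero ∷ select (τ ∘ suc) R
  select {n = suc n} τ (false ∷ R) = select (τ ∘ suc) R

  ^∣∣-∷ : ∀ {n} p s (R : Subset n) → p ^∣ s ∷ R ∣ ≡ (if s then p else 1ℚ) * p ^∣ R ∣
  ^∣∣-∷ p true  R = cong prodℚ (map-allFin-suc (λ j → if does (j ∈? (true ∷ R)) then p else 1ℚ))
  ^∣∣-∷ p false R = cong prodℚ (map-allFin-suc (λ j → if does (j ∈? (false ∷ R)) then p else 1ℚ))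

  sum-subsets≡sublistSum : ∀ {A : Set} (F : List A → ℚ) p n (τ : Fin n → A) ρ →
    sumℚ (map (λ R → F (ρ ++ select τ R) * p ^∣ R ∣) (allSubsets n)) ≡ sublistSum F (λ _ → p) (map τ (allFin n)) ρ
  sum-subsets≡sublistSum F p zero τ ρ =
    trans (ℚP.+-identityʳ _) (trans (ℚP.*-identityʳ _) (cong F (ListP.++-identityʳ ρ)))
  sum-subsets≡sublistSum {A} F p (suc n) τ ρ = begin
    sumℚ (map (term ρ τ) (allSubsets (suc n)))
      ≡⟨ sumℚ-allSubsets-suc n (term ρ τ) ⟩
    sumℚ (map (λ R → term ρ τ (true ∷ R)) 𝒮) + sumℚ (map (λ R → term ρ τ (false ∷ R)) 𝒮)
      ≡⟨ cong₂ _+_ (cong sumℚ (ListP.map-cong chosen 𝒮)) (cong sumℚ (ListP.map-cong skipped 𝒮)) ⟩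
    sumℚ (map (λ R → p * term (ρ ++ [ τ zero ]) (τ ∘ suc) R) 𝒮) + sumℚ (map (term ρ (τ ∘ suc)) 𝒮)
      ≡⟨ cong (_+ sumℚ (map (term ρ (τ ∘ suc)) 𝒮)) (sumℚ-*ˡ p (term (ρ ++ [ τ zero ]) (τ ∘ suc)) 𝒮) ⟩
    p * sumℚ (map (term (ρ ++ [ τ zero ]) (τ ∘ suc)) 𝒮) + sumℚ (map (term ρ (τ ∘ suc)) 𝒮)
      ≡⟨ cong₂ (λ a b → p * a + b) (sum-subsets≡sublistSum F p n (τ ∘ suc) (ρ ++ [ τ zero ]))
                                   (sum-subsets≡sublistSum F p n (τ ∘ suc) ρ) ⟩
    p * sublistSum F (λ _ → p) L (ρ ++ [ τ zero ]) + sublistSum F (λ _ → p) L ρ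
      ≡⟨ ℚP.+-comm (p * sublistSum F (λ _ → p) L (ρ ++ [ τ zero ])) _ ⟩
    sublistSum F (λ _ → p) (τ zero ∷ L) ρ
      ≡⟨ cong (λ L → sublistSum F (λ _ → p) L ρ) (sym (map-allFin-suc τ)) ⟩
    sublistSum F (λ _ → p) (map τ (allFin (suc n))) ρ ∎
    where
    open ≡-Reasoning
    𝒮 = allSubsets n
    L = map (τ ∘ suc) (allFin n)
    term : ∀ {m} → List A → (Fin m → A) → Subset m → ℚ
    term σ τ′ R = F (σ ++ select τ′ R) * p ^∣ R ∣
    chosen : ∀ R → term ρ τ (true ∷ R) ≡ p * term (ρ ++ [ τ zero ]) (τ ∘ suc) R
    chosen R = begin
      F (ρ ++ τ zero ∷ select (τ ∘ suc) R) * p ^∣ true ∷ R ∣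
        ≡⟨ cong₂ _*_ (cong F (sym (ListP.++-assoc ρ [ τ zero ] _))) (^∣∣-∷ p true R) ⟩
      F ((ρ ++ [ τ zero ]) ++ select (τ ∘ suc) R) * (p * p ^∣ R ∣)
        ≡⟨ ℚP.*-comm (F ((ρ ++ [ τ zero ]) ++ select (τ ∘ suc) R)) (p * p ^∣ R ∣) ⟩
      (p * p ^∣ R ∣) * F ((ρ ++ [ τ zero ]) ++ select (τ ∘ suc) R)
        ≡⟨ ℚP.*-assoc p (p ^∣ R ∣) _ ⟩
      p * (p ^∣ R ∣ * F ((ρ ++ [ τ zero ]) ++ select (τ ∘ suc) R))
        ≡⟨ cong (p *_) (ℚP.*-comm (p ^∣ R ∣) _) ⟩
      p * term (ρ ++ [ τ zero ]) (τ ∘ suc) R ∎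
    skipped : ∀ R → term ρ τ (false ∷ R) ≡ term ρ (τ ∘ suc) R
    skipped R = cong (F (ρ ++ select (τ ∘ suc) R) *_) (trans (^∣∣-∷ p false R) (ℚP.*-identityˡ _))

open Sublists

module Covers where
  open import Data.Nat using (_+_; _≤_)

  Trace : Set
  Trace = Vec Bool 4

  -- A player's kind is the trace of its block on B = {x₀, x₁, x₂, x₃}; nothing marks the player being repaired.
  Kind : Set
  Kind = Maybe Trace

  _≟ₖ_ : DecidableEquality Kind
  _≟ₖ_ = MaybeP.≡-dec (VecP.≡-dec BoolP._≟_)

  covers : Fin 4 → Kind → Bool
  covers k nothing  = false
  covers k (just t) = lookup t k

  degree : Fin 4 → List Kind → ℕ
  degree k []      = 0
  degree k (u ∷ ρ) = if covers k u then suc (degree k ρ) else degree k ρ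

  hasPrivatePoint : List Kind → Kind → Bool
  hasPrivatePoint ρ u = any (λ k → covers k u ∧ (degree k ρ ≡ᵇ 1)) (allFin 4)

  irredundant : List Kind → Bool
  irredundant ρ = all (hasPrivatePoint ρ) ρ

  covering : List Kind → Bool
  covering ρ = all (λ k → 1 ≤ᵇ degree k ρ) (allFin 4)

  minimalCover : List Kind → Bool
  minimalCover ρ = covering ρ ∧ irredundant ρ

  coverIndicator : List Kind → ℚ
  coverIndicator ρ = if minimalCover ρ then 1ℚ else 0ℚ

  degree-++ : ∀ k α β → degree k (α ++ β) ≡ degree k α + degree k β
  degree-++ k []      β = refl
  degree-++ k (u ∷ α) β with covers k u
  ... | true  = cong suc (degree-++ k α β)
  ... | false = degree-++ k α β

  degree-positive : ∀ k {ρ u} → u ∈ₗ ρ → T (covers k u) → 1 ≤ degree k ρ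
  degree-positive k {u ∷ ρ} (here refl) c with covers k u
  ... | true = s≤s z≤n
  degree-positive k {u′ ∷ ρ} (there u∈ρ) c with covers k u′
  ... | true  = s≤s z≤n
  ... | false = degree-positive k u∈ρ c

  degree-swap : ∀ k ρ s t γ → degree k (ρ ++ s ∷ t ∷ γ) ≡ degree k (ρ ++ t ∷ s ∷ γ)
  degree-swap k (u ∷ ρ) s t γ with covers k u
  ... | true  = cong suc (degree-swap k ρ s t γ)
  ... | false = degree-swap k ρ s t γ
  degree-swap k [] s t γ with covers k s | covers k t
  ... | true  | true  = refl
  ... | true  | false = refl
  ... | false | true  = refl
  ... | false | false = refl

  all-swap : ∀ {A : Set} (f : A → Bool) ρ s t γ → all f (ρ ++ s ∷ t ∷ γ) ≡ all f (ρ ++ t ∷ s ∷ γ)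
  all-swap f (u ∷ ρ) s t γ = cong (f u ∧_) (all-swap f ρ s t γ)
  all-swap f []      s t γ with f s | f t
  ... | true  | true  = refl
  ... | true  | false = refl
  ... | false | true  = refl
  ... | false | false = refl

  hasPrivatePoint-cong : ∀ {α β} → (∀ k → degree k α ≡ degree k β) → ∀ u → hasPrivatePoint α u ≡ hasPrivatePoint β u
  hasPrivatePoint-cong α≈β u = cong or (ListP.map-cong (λ k → cong (λ d → covers k u ∧ (d ≡ᵇ 1)) (α≈β k)) (allFin 4))

  minimalCover-swap : ∀ ρ s t γ → minimalCover (ρ ++ s ∷ t ∷ γ) ≡ minimalCover (ρ ++ t ∷ s ∷ γ)
  minimalCover-swap ρ s t γ = cong₂ _∧_
    (cong and (ListP.map-cong (λ k → cong (1 ≤ᵇ_) (degree-swap k ρ s t γ)) (allFin 4)))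
    (trans (cong and (ListP.map-cong (hasPrivatePoint-cong {ρ ++ s ∷ t ∷ γ} {ρ ++ t ∷ s ∷ γ} (λ k → degree-swap k ρ s t γ))
                                     (ρ ++ s ∷ t ∷ γ)))
           (all-swap (hasPrivatePoint (ρ ++ t ∷ s ∷ γ)) ρ s t γ))

  coverIndicator-vanish : ∀ {ρ u} → u ∈ₗ ρ → ¬ T (hasPrivatePoint ρ u) → coverIndicator ρ ≡ 0ℚ
  coverIndicator-vanish {ρ} {u} u∈ρ ¬private with minimalCover ρ in eq
  ... | false = refl
  ... | true  = ⊥-elim (¬private (All.lookup (all⁺ (hasPrivatePoint ρ) ρ irr) u∈ρ))
    where
    irr : T (irredundant ρ)
    irr = proj₂ (Equivalence.to BoolP.T-∧ (subst T (sym eq) _))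

  private-point : ∀ ρ u → T (hasPrivatePoint ρ u) → Σ (Fin 4) λ k → T (covers k u) × degree k ρ ≡ 1
  private-point ρ u h with satisfied (any⁻ (λ k → covers k u ∧ (degree k ρ ≡ᵇ 1)) (allFin 4) h)
  ... | k , c = k , proj₁ both , ℕP.≡ᵇ⇒≡ _ 1 (proj₂ both)
    where both = Equivalence.to BoolP.T-∧ c

  private-point⁺ : ∀ ρ u k → T (covers k u) → degree k ρ ≡ 1 → T (hasPrivatePoint ρ u)
  private-point⁺ ρ u k c d≡1 =
    any⁺ (λ k → covers k u ∧ (degree k ρ ≡ᵇ 1)) (lose (∈-allFin k) (Equivalence.from BoolP.T-∧ (c , ℕP.≡⇒≡ᵇ _ 1 d≡1)))

  private-point-prefix : ∀ α γ {u} → u ∈ₗ α → T (hasPrivatePoint (α ++ γ) u) → T (hasPrivatePoint α u)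
  private-point-prefix α γ {u} u∈α h with private-point (α ++ γ) u h
  ... | k , c , d≡1 = private-point⁺ α u k c (ℕP.≤-antisym (ℕP.m+n≤o⇒m≤o (degree k α) ≤1) (degree-positive k u∈α c))
    where
    ≤1 : degree k α + degree k γ ≤ 1
    ≤1 = ℕP.≤-reflexive (trans (sym (degree-++ k α γ)) d≡1)

  irredundant-prefix : ∀ α γ → T (irredundant (α ++ γ)) → T (irredundant α)
  irredundant-prefix α γ h = all⁻ (hasPrivatePoint α) (All.tabulate λ u∈α →
    private-point-prefix α γ u∈α (All.lookup (all⁺ (hasPrivatePoint (α ++ γ)) (α ++ γ) h) (∈-++⁺ˡ u∈α)))

  coverIndicator-prune : ∀ α → ¬ T (irredundant α) → ∀ γ → coverIndicator (α ++ γ) ≡ 0ℚ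
  coverIndicator-prune α ¬irr γ with minimalCover (α ++ γ) in eq
  ... | false = refl
  ... | true  = ⊥-elim (¬irr (irredundant-prefix α γ (proj₂ (Equivalence.to BoolP.T-∧ (subst T (sym eq) _)))))

  coverIndicator-swap : SwapInvariant coverIndicator
  coverIndicator-swap ρ s t γ = cong (if_then 1ℚ else 0ℚ) (minimalCover-swap ρ s t γ)

  coverIndicator-repeats : VanishesOnRepeats coverIndicator
  coverIndicator-repeats ρ t γ = coverIndicator-vanish (∈-++⁺ʳ ρ (here refl)) λ h →
    let k , c , d≡1 = private-point (ρ ++ t ∷ t ∷ γ) t h in
    ℕP.<⇒≢ (ℕP.≤-trans (twice k c) (ℕP.m≤n+m _ (degree k ρ))) (sym (trans (sym (degree-++ k ρ (t ∷ t ∷ γ))) d≡1))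
    where
    twice : ∀ k → T (covers k t) → 2 ≤ degree k (t ∷ t ∷ γ)
    twice k c with covers k t
    ... | true = s≤s (s≤s z≤n)

  coverIndicator-uncovering : ∀ s → (∀ k → covers k s ≡ false) → ∀ α γ → coverIndicator (α ++ s ∷ γ) ≡ 0ℚ
  coverIndicator-uncovering s none α γ = coverIndicator-vanish (∈-++⁺ʳ α (here refl)) λ h →
    let k , c , _ = private-point (α ++ s ∷ γ) s h in subst T (none k) c

  covering⁻ : ∀ ρ → T (covering ρ) → ∀ k → 1 ≤ degree k ρ
  covering⁻ ρ h k = ℕP.≤ᵇ⇒≤ 1 (degree k ρ) (All.lookup (all⁺ (λ k → 1 ≤ᵇ degree k ρ) (allFin 4) h) (∈-allFin k))

  covering⁺ : ∀ ρ → (∀ k → 1 ≤ degree k ρ) → T (covering ρ)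
  covering⁺ ρ h = all⁻ (λ k → 1 ≤ᵇ degree k ρ) {allFin 4} (All.tabulate λ {k} _ → ℕP.≤⇒≤ᵇ (h k))

open Covers

module Counting where
  open import Data.Nat using (_+_; _*_; _≤_)

  𝟙 : Bool → ℕ
  𝟙 true  = 1
  𝟙 false = 0

  count : ∀ {n} → (Fin n → Bool) → ℕ
  count g = sum (𝟙 ∘ g)

  count-cong : ∀ {n} {g h : Fin n → Bool} → (∀ j → g j ≡ h j) → count g ≡ count h
  count-cong g≗h = sum-cong-≗ (cong 𝟙 ∘ g≗h)

  count-positive : ∀ {n} (g : Fin n → Bool) j → T (g j) → 1 ≤ count g
  count-positive g zero    gj with g zero
  ... | true = s≤s z≤n
  count-positive g (suc j) gj with g zero
  ... | true  = s≤s z≤n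
  ... | false = count-positive (g ∘ suc) j gj

  count-witness : ∀ {n} (g : Fin n → Bool) → 1 ≤ count g → Σ (Fin n) (T ∘ g)
  count-witness {suc n} g pos with g zero in g0
  ... | true  = zero , subst T (sym g0) _
  ... | false with count-witness (g ∘ suc) pos
  ...   | j , gj = suc j , gj

  count-two : ∀ {n} (g : Fin n → Bool) {j j′} → j ≢ j′ → T (g j) → T (g j′) → 2 ≤ count g
  count-two g {zero}  {zero}   j≢j′ _ _ = ⊥-elim (j≢j′ refl)
  count-two g {zero}  {suc j′} _ gj gj′ with g zero
  ... | true = s≤s (count-positive (g ∘ suc) j′ gj′)
  count-two g {suc j} {zero}   _ gj gj′ with g zero
  ... | true = s≤s (count-positive (g ∘ suc) j gj)
  count-two g {suc j} {suc j′} j≢j′ gj gj′ with g zero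
  ... | true  = ℕP.m≤n⇒m≤1+n (count-two (g ∘ suc) (j≢j′ ∘ cong suc) gj gj′)
  ... | false = count-two (g ∘ suc) (j≢j′ ∘ cong suc) gj gj′

  count-other : ∀ {n} (g : Fin n → Bool) j → 2 ≤ count g → Σ (Fin n) λ j′ → j′ ≢ j × T (g j′)
  count-other {suc n} g j two with g zero in g0
  count-other {suc n} g zero    (s≤s pos) | true with count-witness (g ∘ suc) pos
  ... | j′ , gj′ = suc j′ , (λ ()) , gj′
  count-other {suc n} g (suc j) _         | true = zero , (λ ()) , subst T (sym g0) _
  count-other {suc n} g zero    two       | false with count-witness (g ∘ suc) (ℕP.≤-trans (s≤s z≤n) two)
  ... | j′ , gj′ = suc j′ , (λ ()) , gj′
  count-other {suc n} g (suc j) two       | false with count-other (g ∘ suc) j two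
  ... | j′ , j′≢j , gj′ = suc j′ , j′≢j ∘ FinP.suc-injective , gj′

  does⇒ : ∀ {P : Set} (P? : Dec P) → T (does P?) → P
  does⇒ (yes p) _ = p

  ⇒does : ∀ {P : Set} (P? : Dec P) → P → T (does P?)
  ⇒does (yes _) _ = _
  ⇒does (no ¬p) p = ¬p p

  𝟙-∧ : ∀ a b → 𝟙 (a ∧ b) ≡ 𝟙 a * 𝟙 b
  𝟙-∧ true  b = sym (ℕP.+-identityʳ (𝟙 b))
  𝟙-∧ false b = refl

  count-false : ∀ n → count {n} (λ _ → false) ≡ 0
  count-false zero    = refl
  count-false (suc n) = count-false n

  count-∧-≟ : ∀ {n} (g : Fin n → Bool) x → count (λ z → g z ∧ does (z ≟ x)) ≡ 𝟙 (g x)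
  count-∧-≟ {suc n} g zero with g zero
  ... | true  = cong suc (trans (count-cong λ z → BoolP.∧-zeroʳ (g (suc z))) (count-false n))
  ... | false = trans (count-cong λ z → BoolP.∧-zeroʳ (g (suc z))) (count-false n)
  count-∧-≟ {suc n} g (suc x) with g zero
  ... | true  = count-∧-≟ (g ∘ suc) x
  ... | false = count-∧-≟ (g ∘ suc) x

  count-≟ : ∀ {n} (x : Fin n) → count (λ z → does (z ≟ x)) ≡ 1
  count-≟ x = count-∧-≟ (λ _ → true) x

  count-split : ∀ {n} (g : Fin n → Bool) x → count g ≡ count (λ z → g z ∧ not (does (z ≟ x))) + 𝟙 (g x)
  count-split g x = begin
    count g
      ≡⟨ sum-cong-≗ (λ z → 𝟙-split (g z) (does (z ≟ x))) ⟩
    sum (λ z → 𝟙 (g z ∧ not (does (z ≟ x))) + 𝟙 (g z ∧ does (z ≟ x)))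
      ≡⟨ ∑-distrib-+ (λ z → 𝟙 (g z ∧ not (does (z ≟ x)))) (λ z → 𝟙 (g z ∧ does (z ≟ x))) ⟩
    count (λ z → g z ∧ not (does (z ≟ x))) + count (λ z → g z ∧ does (z ≟ x))
      ≡⟨ cong (count (λ z → g z ∧ not (does (z ≟ x))) +_) (count-∧-≟ g x) ⟩
    count (λ z → g z ∧ not (does (z ≟ x))) + 𝟙 (g x) ∎
    where
    open ≡-Reasoning
    𝟙-split : ∀ a d → 𝟙 a ≡ 𝟙 (a ∧ not d) + 𝟙 (a ∧ d)
    𝟙-split true  true  = refl
    𝟙-split true  false = refl
    𝟙-split false d     = refl

open Counting

module RepairSets where
  open import Data.Nat using (_≤_)

  x∈⋃⁻ : ∀ {n} {z : Fin n} Ss → z ∈ ⋃ Ss → Σ (Subset n) λ S → S ∈ₗ Ss × z ∈ S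
  x∈⋃⁻ []       z∈⋃ = ⊥-elim (∉⊥ z∈⋃)
  x∈⋃⁻ (S ∷ Ss) z∈⋃ with x∈p∪q⁻ S (⋃ Ss) z∈⋃
  ... | inj₁ z∈S = S , here refl , z∈S
  ... | inj₂ z∈⋃′ with x∈⋃⁻ Ss z∈⋃′
  ...   | S′ , S′∈Ss , z∈S′ = S′ , there S′∈Ss , z∈S′

  x∈⋃⁺ : ∀ {n} {z : Fin n} {S} Ss → S ∈ₗ Ss → z ∈ S → z ∈ ⋃ Ss
  x∈⋃⁺ (S ∷ Ss) (here refl)  z∈S = x∈p∪q⁺ (inj₁ z∈S)
  x∈⋃⁺ (S ∷ Ss) (there S∈Ss) z∈S = x∈p∪q⁺ {p = S} (inj₂ (x∈⋃⁺ Ss S∈Ss z∈S))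

  _without_ : ∀ {n} → Subset n → Fin n → Subset n
  R without j = R [ j ]≔ outside

  ∉-without : ∀ {n} (R : Subset n) j → j ∉ R without j
  ∉-without R j j∈ with VecP.[]=-injective j∈ (VecP.[]≔-updates R j)
  ... | ()

  ∈-without⁺ : ∀ {n} {R : Subset n} {j z} → z ≢ j → z ∈ R → z ∈ R without j
  ∈-without⁺ {R = R} {j} {z} z≢j = VecP.[]≔-minimal R z j z≢j

  ∈-without⁻ : ∀ {n} {R : Subset n} {j z} → z ∈ R without j → z ∈ R
  ∈-without⁻ {R = R} {j} {z} z∈ with z ≟ j
  ... | yes refl = ⊥-elim (∉-without R j z∈)
  ... | no z≢j   = VecP.lookup⇒[]= z R (trans (sym (VecP.lookup∘update′ z≢j R outside)) (VecP.[]=⇒lookup z∈))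

  without⊂ : ∀ {n} {R : Subset n} {j} → j ∈ R → R without j ⊂ R
  without⊂ {R = R} {j} j∈R = ∈-without⁻ , j , j∈R , ∉-without R j

  degree-select : ∀ {n} (τ : Fin n → Kind) R k →
                  degree k (select τ R) ≡ count (λ j → does (j ∈? R) ∧ covers k (τ j))
  degree-select {zero}  τ []          k = refl
  degree-select {suc n} τ (true ∷ R)  k with covers k (τ zero)
  ... | true  = cong suc (degree-select (τ ∘ suc) R k)
  ... | false = degree-select (τ ∘ suc) R k
  degree-select {suc n} τ (false ∷ R) k = degree-select (τ ∘ suc) R k

  module _ {A : Set} where

    ∈-select : ∀ {n} (τ : Fin n → A) {R j} → j ∈ R → τ j ∈ₗ select τ R
    ∈-select τ {inside  ∷ R} Vec.here        = here refl
    ∈-select τ {inside  ∷ R} (Vec.there j∈R) = there (∈-select (τ ∘ suc) j∈R)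
    ∈-select τ {outside ∷ R} (Vec.there j∈R) = ∈-select (τ ∘ suc) j∈R

    all-select⁻ : ∀ {n} (f : A → Bool) (τ : Fin n → A) R → T (all f (select τ R)) → ∀ {j} → j ∈ R → T (f (τ j))
    all-select⁻ f τ R h j∈R = All.lookup (all⁺ f (select τ R) h) (∈-select τ j∈R)

    all-select⁺ : ∀ {n} (f : A → Bool) (τ : Fin n → A) R → (∀ {j} → j ∈ R → T (f (τ j))) → T (all f (select τ R))
    all-select⁺ f τ []            h = _
    all-select⁺ f τ (inside  ∷ R) h = Equivalence.from BoolP.T-∧ (h Vec.here , all-select⁺ f (τ ∘ suc) R (h ∘ Vec.there))
    all-select⁺ f τ (outside ∷ R) h = all-select⁺ f (τ ∘ suc) R (h ∘ Vec.there)

  module _ {v : ℕ} (D : SQS v) where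
    open SQS D

    ∈-unionOf⁻ : ∀ {R z} → z ∈ unionOf D R → Σ (Fin b) λ j → j ∈ R × z ∈ block j
    ∈-unionOf⁻ {R} z∈ with x∈⋃⁻ (map block (filter (_∈? R) (allFin b))) z∈
    ... | S , S∈ , z∈S with ∈-map⁻ block S∈
    ...   | j , j∈ , refl = j , proj₂ (∈-filter⁻ (_∈? R) {xs = allFin b} j∈) , z∈S

    ∈-unionOf⁺ : ∀ {R z} j → j ∈ R → z ∈ block j → z ∈ unionOf D R
    ∈-unionOf⁺ {R} j j∈R z∈j =
      x∈⋃⁺ (map block (filter (_∈? R) (allFin b))) (∈-map⁺ block (∈-filter⁺ (_∈? R) (∈-allFin j) j∈R)) z∈j

  module Players {v : ℕ} (D : SQS v) (i : Fin (SQS.b D)) (x : Fin 4 → Fin v) where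
    open SQS D

    trace : Fin b → Trace
    trace j = tabulate (λ k → does (x k ∈? block j))

    kind : Fin b → Kind
    kind j = if does (j ≟ i) then nothing else just (trace j)

    covers-kind⁻ : ∀ k j → T (covers k (kind j)) → j ≢ i × x k ∈ block j
    covers-kind⁻ k j c with j ≟ i
    ... | no j≢i = j≢i , does⇒ (x k ∈? block j) (subst T (VecP.lookup∘tabulate (λ k → does (x k ∈? block j)) k) c)

    covers-kind⁺ : ∀ k j → j ≢ i → x k ∈ block j → T (covers k (kind j))
    covers-kind⁺ k j j≢i xk∈j with j ≟ i
    ... | yes j≡i = ⊥-elim (j≢i j≡i)
    ... | no _    = subst T (sym (VecP.lookup∘tabulate (λ k → does (x k ∈? block j)) k)) (⇒does (x k ∈? block j) xk∈j)

    coverers : Subset b → Fin 4 → Fin b → Bool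
    coverers R k j = does (j ∈? R) ∧ covers k (kind j)

    coverer⁺ : ∀ {R k j} → j ∈ R → j ≢ i → x k ∈ block j → T (coverers R k j)
    coverer⁺ {R} {k} {j} j∈R j≢i xk∈j = Equivalence.from BoolP.T-∧ (⇒does (j ∈? R) j∈R , covers-kind⁺ k j j≢i xk∈j)

    coverer⁻ : ∀ {R k j} → T (coverers R k j) → j ∈ R × x k ∈ block j
    coverer⁻ {R} {k} {j} c with Equivalence.to BoolP.T-∧ c
    ... | j∈R , ck = does⇒ (j ∈? R) j∈R , proj₂ (covers-kind⁻ k j ck)

    coverer-transfer : ∀ {R R′ k j} → (j ∈ R → j ∈ R′) → T (coverers R k j) → T (coverers R′ k j)
    coverer-transfer {R} {R′} {k} {j} f c with Equivalence.to BoolP.T-∧ c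
    ... | j∈R , ck = Equivalence.from BoolP.T-∧ (⇒does (j ∈? R′) (f (does⇒ (j ∈? R) j∈R)) , ck)

    coverers-count : ∀ R k → degree k (select kind R) ≡ count (coverers R k)
    coverers-count R k = degree-select kind R k

    module _ (x∈B : ∀ k → x k ∈ block i) (x-onto : ∀ z → z ∈ block i → Σ (Fin 4) λ k → x k ≡ z) where

      repairSet-coverer : ∀ {R} → IsRepairSet D i R → ∀ k → Σ (Fin b) λ j → T (coverers R k j)
      repairSet-coverer (i∉R , B⊆⋃R) k with ∈-unionOf⁻ D (B⊆⋃R (x∈B k))
      ... | j , j∈R , xk∈j = j , coverer⁺ j∈R (λ { refl → i∉R j∈R }) xk∈j

      coverers⇒repairSet : ∀ {R} → i ∉ R → (∀ k → Σ (Fin b) λ j → T (coverers R k j)) → IsRepairSet D i R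
      coverers⇒repairSet {R} i∉R cover = i∉R , B⊆⋃R
        where
        B⊆⋃R : block i ⊆ unionOf D R
        B⊆⋃R z∈B with x-onto _ z∈B
        ... | k , refl = let j , c = cover k ; j∈R , xk∈j = coverer⁻ c in ∈-unionOf⁺ D j j∈R xk∈j

      repairSet-degree : ∀ {R} → IsRepairSet D i R → ∀ k → 1 ≤ degree k (select kind R)
      repairSet-degree {R} rep k = let j , c = repairSet-coverer rep k in
        subst (1 ≤_) (sym (coverers-count R k)) (count-positive (coverers R k) j c)

      without-redundant : ∀ {R} → IsRepairSet D i R → ∀ {j} →
                          ¬ T (hasPrivatePoint (select kind R) (kind j)) → IsRepairSet D i (R without j)
      without-redundant {R} rep {j} redundant = coverers⇒repairSet (proj₁ rep ∘ ∈-without⁻) cover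
        where
        cover : ∀ k → Σ (Fin b) λ j′ → T (coverers (R without j) k j′)
        cover k with repairSet-coverer rep k
        ... | j₀ , c₀ with j₀ ≟ j
        ...   | no j₀≢j = j₀ , coverer-transfer (∈-without⁺ j₀≢j) c₀
        ...   | yes refl with count-other (coverers R k) j₀ shared
          where
          shared : 2 ≤ count (coverers R k)
          shared = subst (2 ≤_) (coverers-count R k) (ℕP.≤∧≢⇒< (repairSet-degree rep k) λ 1≡d →
            redundant (private-point⁺ (select kind R) (kind j₀) k (proj₂ (Equivalence.to BoolP.T-∧ c₀)) (sym 1≡d)))
        ...     | j₁ , j₁≢j , c₁ = j₁ , coverer-transfer (∈-without⁺ j₁≢j) c₁

      minimalCover⇒minimal : ∀ R → T (minimalCover (select kind R)) → IsMinimalRepairSet D i R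
      minimalCover⇒minimal R good = coverers⇒repairSet i∉R cover , minimal
        where
        σ = select kind R
        private-of : ∀ {j} → j ∈ R → Σ (Fin 4) λ k → T (covers k (kind j)) × degree k σ ≡ 1
        private-of {j} j∈R = private-point σ (kind j)
          (all-select⁻ (hasPrivatePoint σ) kind R (proj₂ (Equivalence.to BoolP.T-∧ good)) j∈R)
        i∉R : i ∉ R
        i∉R i∈R = let k , c , _ = private-of i∈R in proj₁ (covers-kind⁻ k i c) refl
        cover : ∀ k → Σ (Fin b) λ j → T (coverers R k j)
        cover k = count-witness (coverers R k)
          (subst (1 ≤_) (coverers-count R k) (covering⁻ σ (proj₁ (Equivalence.to BoolP.T-∧ good)) k))
        minimal : ∀ R′ → R′ ⊂ R → ¬ IsRepairSet D i R′
        minimal R′ (R′⊆R , j , j∈R , j∉R′) rep′ with private-of j∈R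
        ... | k , c , d≡1 with repairSet-coverer rep′ k
        ...   | j′ , c′ = ℕP.<⇒≢ two (sym (trans (sym (coverers-count R k)) d≡1))
          where
          two : 2 ≤ count (coverers R k)
          two = count-two (coverers R k) {j} {j′} (λ { refl → j∉R′ (proj₁ (coverer⁻ {R′} {k} {j′} c′)) })
                  (Equivalence.from BoolP.T-∧ (⇒does (j ∈? R) j∈R , c)) (coverer-transfer {R′} {R} {k} {j′} R′⊆R c′)

      minimal⇒minimalCover : ∀ R → IsMinimalRepairSet D i R → T (minimalCover (select kind R))
      minimal⇒minimalCover R (rep , minimal) =
        Equivalence.from BoolP.T-∧ (covering⁺ σ (repairSet-degree rep) , all-select⁺ (hasPrivatePoint σ) kind R essential)
        where
        σ = select kind R
        essential : ∀ {j} → j ∈ R → T (hasPrivatePoint σ (kind j))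
        essential {j} j∈R with hasPrivatePoint σ (kind j) in eq
        ... | true  = _
        ... | false = ⊥-elim (minimal (R without j) (without⊂ j∈R) (without-redundant rep (subst T eq)))

      minimalIndicator≡coverIndicator : ∀ R → indicator (isMinimalRepairSet? D i R) ≡ coverIndicator (select kind R)
      minimalIndicator≡coverIndicator R with isMinimalRepairSet? D i R | minimalCover (select kind R) in eq
      ... | yes m | true  = refl
      ... | yes m | false = ⊥-elim (subst T eq (minimal⇒minimalCover R m))
      ... | no ¬m | true  = ⊥-elim (¬m (minimalCover⇒minimal R (subst T (sym eq) _)))
      ... | no ¬m | false = refl

open RepairSets

module DoubleCounting where
  open import Data.Nat using (_+_; _*_)

  count-true : ∀ n → count {n} (λ _ → true) ≡ n
  count-true zero    = refl
  count-true (suc n) = cong suc (count-true n)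

  ∣∣≡count : ∀ {n} (S : Subset n) → ∣ S ∣ ≡ count (λ z → does (z ∈? S))
  ∣∣≡count []          = refl
  ∣∣≡count (true ∷ S)  = cong suc (∣∣≡count S)
  ∣∣≡count (false ∷ S) = ∣∣≡count S

  does-∈?-tabulate : ∀ {n} (f : Fin n → Bool) z → does (z ∈? tabulate f) ≡ f z
  does-∈?-tabulate f zero    with f zero
  ... | true  = refl
  ... | false = refl
  does-∈?-tabulate f (suc z) = does-∈?-tabulate (f ∘ suc) z

  count-unique : ∀ {n} (g : Fin n → Bool) j₀ → (∀ j → T (g j) → j ≡ j₀) → T (g j₀) → count g ≡ 1
  count-unique g j₀ unique gj₀ = trans (count-cong same) (count-≟ j₀)
    where
    same : ∀ j → g j ≡ does (j ≟ j₀)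
    same j with j ≟ j₀
    ... | yes refl = Equivalence.to BoolP.T-≡ gj₀
    ... | no j≢j₀ with g j in gj
    ...   | true  = ⊥-elim (j≢j₀ (unique j (subst T (sym gj) _)))
    ...   | false = refl

  count-split₂ : ∀ {n} (g : Fin n → Bool) {x y} → x ≢ y →
    count g ≡ count (λ z → g z ∧ (not (does (z ≟ x)) ∧ not (does (z ≟ y)))) + 𝟙 (g y) + 𝟙 (g x)
  count-split₂ g {x} {y} x≢y = begin
    count g
      ≡⟨ count-split g x ⟩
    count (λ z → g z ∧ not (does (z ≟ x))) + 𝟙 (g x)
      ≡⟨ cong (_+ 𝟙 (g x)) (count-split (λ z → g z ∧ not (does (z ≟ x))) y) ⟩
    count (λ z → (g z ∧ not (does (z ≟ x))) ∧ not (does (z ≟ y))) + 𝟙 (g y ∧ not (does (y ≟ x))) + 𝟙 (g x)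
      ≡⟨ cong₂ (λ a c → a + 𝟙 c + 𝟙 (g x)) (count-cong (λ z → BoolP.∧-assoc (g z) _ _)) y≠x ⟩
    count (λ z → g z ∧ (not (does (z ≟ x)) ∧ not (does (z ≟ y)))) + 𝟙 (g y) + 𝟙 (g x) ∎
    where
    open ≡-Reasoning
    y≠x : g y ∧ not (does (y ≟ x)) ≡ g y
    y≠x rewrite dec-false (y ≟ x) (x≢y ∘ sym) = BoolP.∧-identityʳ (g y)

  module _ {v : ℕ} (D : SQS v) where
    open SQS D

    mem : Fin b → Fin v → Bool
    mem j z = does (z ∈? block j)

    block-count : ∀ j → count (mem j) ≡ 4
    block-count j = trans (sym (∣∣≡count (block j))) (blockSize j)

    module _ {x y z : Fin v} (x≢y : x ≢ y) (x≢z : x ≢ z) (y≢z : y ≢ z) where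

      private
        is : Fin v → Bool
        is w = does (w ≟ x) ∨ does (w ≟ y) ∨ does (w ≟ z)

        triple : Subset v
        triple = tabulate is

        𝟙-is : ∀ w → 𝟙 (is w) ≡ 𝟙 (does (w ≟ x)) + 𝟙 (does (w ≟ y)) + 𝟙 (does (w ≟ z))
        𝟙-is w with w ≟ x | w ≟ y | w ≟ z
        ... | yes refl | yes refl | _        = ⊥-elim (x≢y refl)
        ... | yes refl | no _     | yes refl = ⊥-elim (x≢z refl)
        ... | yes refl | no _     | no _     = refl
        ... | no _     | yes refl | yes refl = ⊥-elim (y≢z refl)
        ... | no _     | yes refl | no _     = refl
        ... | no _     | no _     | yes _    = refl
        ... | no _     | no _     | no _     = refl

        ∣triple∣≡3 : ∣ triple ∣ ≡ 3
        ∣triple∣≡3 = begin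
          ∣ triple ∣                              ≡⟨ ∣∣≡count triple ⟩
          count (λ w → does (w ∈? triple))        ≡⟨ count-cong (does-∈?-tabulate is) ⟩
          count is                                ≡⟨ sum-cong-≗ 𝟙-is ⟩
          sum (λ w → 𝟙 (does (w ≟ x)) + 𝟙 (does (w ≟ y)) + 𝟙 (does (w ≟ z)))
            ≡⟨ ∑-distrib-+ (λ w → 𝟙 (does (w ≟ x)) + 𝟙 (does (w ≟ y))) (λ w → 𝟙 (does (w ≟ z))) ⟩
          sum (λ w → 𝟙 (does (w ≟ x)) + 𝟙 (does (w ≟ y))) + count (λ w → does (w ≟ z))
            ≡⟨ cong (_+ count (λ w → does (w ≟ z))) (∑-distrib-+ (λ w → 𝟙 (does (w ≟ x))) (λ w → 𝟙 (does (w ≟ y)))) ⟩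
          count (λ w → does (w ≟ x)) + count (λ w → does (w ≟ y)) + count (λ w → does (w ≟ z))
            ≡⟨ cong₂ _+_ (cong₂ _+_ (count-≟ x) (count-≟ y)) (count-≟ z) ⟩
          3 ∎
          where open ≡-Reasoning

        ∈-triple⁺ : ∀ {w} → T (is w) → w ∈ triple
        ∈-triple⁺ {w} h = does⇒ (w ∈? triple) (subst T (sym (does-∈?-tabulate is w)) h)

        ∈-triple⁻ : ∀ {w} → w ∈ triple → T (is w)
        ∈-triple⁻ {w} w∈ = subst T (does-∈?-tabulate is w) (⇒does (w ∈? triple) w∈)

        through⇒⊆ : ∀ j → T (mem j x ∧ mem j y ∧ mem j z) → triple ⊆ block j
        through⇒⊆ j h {w} w∈ with Equivalence.to BoolP.T-∧ h
        ... | mx , myz with Equivalence.to BoolP.T-∧ myz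
        ...   | my , mz with Equivalence.to BoolP.T-∨ (∈-triple⁻ w∈)
        ...     | inj₁ w≡x = subst (_∈ block j) (sym (does⇒ (w ≟ x) w≡x)) (does⇒ (x ∈? block j) mx)
        ...     | inj₂ w≡y∨z with Equivalence.to BoolP.T-∨ w≡y∨z
        ...       | inj₁ w≡y = subst (_∈ block j) (sym (does⇒ (w ≟ y) w≡y)) (does⇒ (y ∈? block j) my)
        ...       | inj₂ w≡z = subst (_∈ block j) (sym (does⇒ (w ≟ z) w≡z)) (does⇒ (z ∈? block j) mz)

        ⊆⇒through : ∀ j → triple ⊆ block j → T (mem j x ∧ mem j y ∧ mem j z)
        ⊆⇒through j ⊆j = Equivalence.from BoolP.T-∧ (inj x (inj₁ (⇒does (x ≟ x) refl)) ,
          Equivalence.from BoolP.T-∧ (inj y (inj₂ (Equivalence.from BoolP.T-∨ (inj₁ (⇒does (y ≟ y) refl)))) ,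
                                      inj z (inj₂ (Equivalence.from BoolP.T-∨ (inj₂ (⇒does (z ≟ z) refl))))))
          where
          inj : ∀ w → T (does (w ≟ x)) ⊎ T (does (w ≟ y) ∨ does (w ≟ z)) → T (mem j w)
          inj w h = ⇒does (w ∈? block j) (⊆j (∈-triple⁺ (Equivalence.from BoolP.T-∨ h)))

      count-through₃ : count (λ j → mem j x ∧ mem j y ∧ mem j z) ≡ 1
      count-through₃ with unique3 triple ∣triple∣≡3
      ... | j₀ , triple⊆j₀ , unique =
        count-unique (λ j → mem j x ∧ mem j y ∧ mem j z) j₀ (λ j h → unique j (through⇒⊆ j h)) (⊆⇒through j₀ triple⊆j₀)

    through₂ : Fin v → Fin v → ℕ
    through₂ x y = count (λ j → mem j x ∧ mem j y)

    through₁ : Fin v → ℕ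
    through₁ x = count (λ j → mem j x)

    private
      𝟙-T : ∀ {a} → T a → 𝟙 a ≡ 1
      𝟙-T {true} _ = refl

      ∧∧-false : ∀ a b c → a ∧ b ∧ (c ∧ false) ≡ false
      ∧∧-false a b c rewrite BoolP.∧-zeroʳ c | BoolP.∧-zeroʳ b = BoolP.∧-zeroʳ a

    through₂-degree : ∀ {x y} → x ≢ y → 2 * through₂ x y + 2 ≡ v
    through₂-degree {x} {y} x≢y = begin
      2 * through₂ x y + 2
        ≡⟨ cong (_+ 2) (*-distribˡ-sum 2 (λ j → 𝟙 (mem j x ∧ mem j y))) ⟩
      sum (λ j → 2 * 𝟙 (mem j x ∧ mem j y)) + 2
        ≡⟨ cong (_+ 2) (sum-cong-≗ (sym ∘ row)) ⟩
      sum (λ j → sum (flag j)) + 2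
        ≡⟨ cong (_+ 2) (∑-comm flag) ⟩
      sum (λ z → sum (λ j → flag j z)) + 2
        ≡⟨ cong (_+ 2) (sum-cong-≗ column) ⟩
      count others + 2
        ≡⟨ sym (trans (count-split₂ (λ _ → true) x≢y) (ℕP.+-assoc (count others) 1 1)) ⟩
      count {v} (λ _ → true)
        ≡⟨ count-true v ⟩
      v ∎
      where
      open ≡-Reasoning
      others : Fin v → Bool
      others z = not (does (z ≟ x)) ∧ not (does (z ≟ y))
      flag : Fin b → Fin v → ℕ
      flag j z = 𝟙 (mem j x ∧ mem j y ∧ (mem j z ∧ others z))
      two-others : ∀ j → T (mem j x) → T (mem j y) → count (λ z → mem j z ∧ others z) ≡ 2
      two-others j jx jy = ℕP.+-cancelʳ-≡ 2 _ 2 (begin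
        count (λ z → mem j z ∧ others z) + 2   ≡⟨ ℕP.+-assoc (count (λ z → mem j z ∧ others z)) 1 1 ⟨
        count (λ z → mem j z ∧ others z) + 1 + 1
          ≡⟨ cong₂ (λ a c → count (λ z → mem j z ∧ others z) + a + c) (𝟙-T jy) (𝟙-T jx) ⟨
        count (λ z → mem j z ∧ others z) + 𝟙 (mem j y) + 𝟙 (mem j x)   ≡⟨ count-split₂ (mem j) x≢y ⟨
        count (mem j)                          ≡⟨ block-count j ⟩
        4 ∎)
      row : ∀ j → sum (flag j) ≡ 2 * 𝟙 (mem j x ∧ mem j y)
      row j with mem j x in jx | mem j y in jy
      ... | false | _     = count-false v
      ... | true  | false = count-false v
      ... | true  | true  = two-others j (subst T (sym jx) _) (subst T (sym jy) _)
      column : ∀ z → sum (λ j → flag j z) ≡ 𝟙 (others z)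
      column z with z ≟ x | z ≟ y
      ... | yes _ | _     = trans (count-cong λ j → ∧∧-false (mem j x) (mem j y) (mem j z)) (count-false b)
      ... | no _  | yes _ = trans (count-cong λ j → ∧∧-false (mem j x) (mem j y) (mem j z)) (count-false b)
      ... | no z≢x | no z≢y = trans (count-cong λ j → cong (λ c → mem j x ∧ mem j y ∧ c) (BoolP.∧-identityʳ (mem j z)))
                                    (count-through₃ x≢y (z≢x ∘ sym) (z≢y ∘ sym))

    through₂-constant : ∀ {x y y′} → x ≢ y → x ≢ y′ → through₂ x y ≡ through₂ x y′
    through₂-constant x≢y x≢y′ =
      ℕP.*-cancelˡ-≡ _ _ 2 (ℕP.+-cancelʳ-≡ 2 _ _ (trans (through₂-degree x≢y) (sym (through₂-degree x≢y′))))

    through₁-degree : ∀ {x y} → x ≢ y → 3 * through₁ x ≡ (2 * through₂ x y + 1) * through₂ x y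
    through₁-degree {x} {y₀} x≢y₀ = begin
      3 * through₁ x
        ≡⟨ *-distribˡ-sum 3 (λ j → 𝟙 (mem j x)) ⟩
      sum (λ j → 3 * 𝟙 (mem j x))
        ≡⟨ sum-cong-≗ (sym ∘ row) ⟩
      sum (λ j → sum (flag j))
        ≡⟨ ∑-comm flag ⟩
      sum (λ y → sum (λ j → flag j y))
        ≡⟨ sum-cong-≗ column ⟩
      sum (λ y → A * 𝟙 (not (does (y ≟ x))))
        ≡⟨ *-distribˡ-sum A (λ y → 𝟙 (not (does (y ≟ x)))) ⟨
      A * count (λ y → not (does (y ≟ x)))
        ≡⟨ cong (A *_) (ℕP.+-cancelʳ-≡ 1 _ _ others) ⟩
      A * (2 * A + 1)
        ≡⟨ ℕP.*-comm A _ ⟩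
      (2 * A + 1) * A ∎
      where
      open ≡-Reasoning
      A = through₂ x y₀
      flag : Fin b → Fin v → ℕ
      flag j y = 𝟙 (mem j x ∧ (mem j y ∧ not (does (y ≟ x))))
      row : ∀ j → sum (flag j) ≡ 3 * 𝟙 (mem j x)
      row j with mem j x in jx
      ... | false = count-false v
      ... | true  = ℕP.+-cancelʳ-≡ 1 _ 3 (begin
        count (λ y → mem j y ∧ not (does (y ≟ x))) + 1
          ≡⟨ cong (count (λ y → mem j y ∧ not (does (y ≟ x))) +_) (𝟙-T (subst T (sym jx) _)) ⟨
        count (λ y → mem j y ∧ not (does (y ≟ x))) + 𝟙 (mem j x)  ≡⟨ count-split (mem j) x ⟨
        count (mem j)                                              ≡⟨ block-count j ⟩
        4 ∎)
      column : ∀ y → sum (λ j → flag j y) ≡ A * 𝟙 (not (does (y ≟ x)))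
      column y with y ≟ x
      ... | yes refl = trans (count-cong λ j → trans (cong (mem j y ∧_) (BoolP.∧-zeroʳ (mem j y))) (BoolP.∧-zeroʳ (mem j y)))
                             (trans (count-false b) (sym (ℕP.*-zeroʳ A)))
      ... | no y≢x = begin
        count (λ j → mem j x ∧ (mem j y ∧ true))   ≡⟨ count-cong (λ j → cong (mem j x ∧_) (BoolP.∧-identityʳ (mem j y))) ⟩
        through₂ x y                               ≡⟨ through₂-constant (y≢x ∘ sym) x≢y₀ ⟩
        A                                          ≡⟨ ℕP.*-identityʳ A ⟨
        A * 1 ∎
      others : count (λ y → not (does (y ≟ x))) + 1 ≡ 2 * A + 1 + 1
      others = begin
        count (λ y → not (does (y ≟ x))) + 1   ≡⟨ count-split (λ _ → true) x ⟨
        count {v} (λ _ → true)                 ≡⟨ count-true v ⟩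
        v                                      ≡⟨ through₂-degree x≢y₀ ⟨
        2 * A + 2                              ≡⟨ ℕP.+-assoc (2 * A) 1 1 ⟨
        2 * A + 1 + 1 ∎


open DoubleCounting

module Parameters where
  open import Data.Nat using (_+_; _*_; _∸_)
  open ℤ using (+_)
  open Data.Nat.Solver.+-*-Solver using (solve; con; _:+_; _:*_; _:=_)

  2*nC2+n≡n*n : ∀ n → 2 * (n C 2) + n ≡ n * n
  2*nC2+n≡n*n zero    = refl
  2*nC2+n≡n*n (suc n) = begin
    2 * (suc n C 2) + suc n
      ≡⟨ cong (λ c → 2 * c + suc n) (sym (nCk+nC[k+1]≡[n+1]C[k+1] n 1)) ⟩
    2 * (n C 1 + n C 2) + suc n
      ≡⟨ cong (λ c → 2 * (c + n C 2) + suc n) (nC1≡n n) ⟩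
    2 * (n + n C 2) + suc n
      ≡⟨ solve 2 (λ n c → con 2 :* (n :+ c) :+ (con 1 :+ n)
                         := (con 2 :* c :+ n) :+ (con 1 :+ con 2 :* n)) refl n (n C 2) ⟩
    (2 * (n C 2) + n) + (1 + 2 * n)
      ≡⟨ cong (_+ (1 + 2 * n)) (2*nC2+n≡n*n n) ⟩
    n * n + (1 + 2 * n)
      ≡⟨ solve 1 (λ n → n :* n :+ (con 1 :+ con 2 :* n)
                       := (con 1 :+ n) :* (con 1 :+ n)) refl n ⟩
    suc n * suc n ∎
    where open ≡-Reasoning

  r₂≡ : ∀ {v} A → 2 * A + 2 ≡ v → r₂ v ≡ ℕtoℚ A
  r₂≡ A refl = ℚP.fromℚᵘ-cong {mkℚᵘ (+ (2 * A + 2) ℤ.- + 2) 1} {mkℚᵘ (+ A) 0}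
    (*≡* (trans (cong (ℤ._* + 1) numerator)
      (ℤS.solve 1 (λ a → (a ℤS.:+ (a ℤS.:+ ℤS.con (+ 0))) ℤS.:* ℤS.con (+ 1) ℤS.:= a ℤS.:* ℤS.con (+ 2)) refl (+ A))))
    where
    numerator : + (2 * A + 2) ℤ.- + 2 ≡ + (2 * A)
    numerator = trans (ℤP.m-n≡m⊖n (2 * A + 2) 2)
      (trans (ℤP.⊖-≥ (ℕP.m≤n+m 2 (2 * A))) (cong +_ (ℕP.m+n∸n≡m (2 * A) 2)))

  r₁≡ : ∀ {v} A P → 2 * A + 2 ≡ v → 3 * P ≡ (2 * A + 1) * A → r₁ v ≡ ℕtoℚ P
  r₁≡ A P refl 3P≡ = ℚP.fromℚᵘ-cong {mkℚᵘ (+ ((2 * A + 2 ∸ 1) C 2)) 2} {mkℚᵘ (+ P) 0}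
    (*≡* (trans (cong (λ c → + c ℤ.* + 1) choose)
      (ℤS.solve 1 (λ p → (p ℤS.:+ (p ℤS.:+ (p ℤS.:+ ℤS.con (+ 0)))) ℤS.:* ℤS.con (+ 1) ℤS.:= p ℤS.:* ℤS.con (+ 3))
        refl (+ P))))
    where
    n = 2 * A + 1
    v-1≡n : 2 * A + 2 ∸ 1 ≡ n
    v-1≡n rewrite ℕP.+-comm (2 * A) 2 | ℕP.+-comm (2 * A) 1 = refl
    n*n : n * n ≡ 2 * (n * A) + n
    n*n = solve 1 (λ a → (con 2 :* a :+ con 1) :* (con 2 :* a :+ con 1)
                       := con 2 :* ((con 2 :* a :+ con 1) :* a) :+ (con 2 :* a :+ con 1)) refl A
    choose : (2 * A + 2 ∸ 1) C 2 ≡ 3 * P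
    choose = trans (cong (_C 2) v-1≡n)
      (trans (ℕP.*-cancelˡ-≡ (n C 2) (n * A) 2 (ℕP.+-cancelʳ-≡ n _ _ (trans (2*nC2+n≡n*n n) n*n))) (sym 3P≡))

open Parameters

module KindCounts where
  open import Data.Nat using (_+_; _*_)

  _≟ₜ_ : (s t : Trace) → Dec (s ≡ t)
  _≟ₜ_ = VecP.≡-dec BoolP._≟_

  pointTrace : Fin 4 → Trace
  pointTrace k = tabulate (λ m → does (m ≟ k))

  pairTrace : Fin 4 → Fin 4 → Trace
  pairTrace k l = tabulate (λ m → does (m ≟ k) ∨ does (m ≟ l))

  atMostTwo : Trace → Bool
  atMostTwo (a ∷ b ∷ c ∷ d ∷ []) = not (a ∧ b ∧ c ∨ a ∧ b ∧ d ∨ a ∧ c ∧ d ∨ b ∧ c ∧ d)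

  -- pair-trace and point-trace are facts about the sixteen traces, decided by evaluating them on all of them.
  all⇒∀ : ∀ {A : Set} {xs : List A} → (∀ x → x ∈ₗ xs) → ∀ (f : A → Bool) → T (all f xs) → ∀ x → T (f x)
  all⇒∀ {xs = xs} complete f h x = All.lookup (all⁺ f xs h) (complete x)

  checkPoints : (Fin 4 → Trace → Bool) → Bool
  checkPoints c = all (λ k → all (c k) (allSubsets 4)) (allFin 4)

  checkPoints-sound : ∀ c → T (checkPoints c) → ∀ k t → T (c k t)
  checkPoints-sound c h k = all⇒∀ ∈-allSubsets (c k) (all⇒∀ ∈-allFin (λ k → all (c k) (allSubsets 4)) h k)

  checkPairs : (Fin 4 → Fin 4 → Trace → Bool) → Bool
  checkPairs c = all (λ k → checkPoints (c k)) (allFin 4)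

  checkPairs-sound : ∀ c → T (checkPairs c) → ∀ k l t → T (c k l t)
  checkPairs-sound c h k = checkPoints-sound (c k) (all⇒∀ ∈-allFin (λ k → checkPoints (c k)) h k)

  pair-trace : ∀ {k l} → k ≢ l → ∀ t → T (atMostTwo t) →
               𝟙 (lookup t k ∧ lookup t l) ≡ 𝟙 (does (pairTrace k l ≟ₜ t))
  pair-trace {k} {l} k≢l t t≤2 =
    ℕP.≡ᵇ⇒≡ _ _ (resolve (does (k ≟ l)) (dec-false (k ≟ l) k≢l) (atMostTwo t) t≤2 (checkPairs-sound check _ k l t))
    where
    check : Fin 4 → Fin 4 → Trace → Bool
    check k l t = does (k ≟ l) ∨ not (atMostTwo t) ∨ (𝟙 (lookup t k ∧ lookup t l) ≡ᵇ 𝟙 (does (pairTrace k l ≟ₜ t)))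
    resolve : ∀ d → d ≡ false → ∀ a → T a → ∀ {e} → T (d ∨ not a ∨ e) → T e
    resolve false _ true _ h = h

  point-trace : ∀ k t → T (atMostTwo t) →
    𝟙 (lookup t k) ≡ 𝟙 (does (pointTrace k ≟ₜ t)) + count (λ l → not (does (l ≟ k)) ∧ does (pairTrace k l ≟ₜ t))
  point-trace k t t≤2 = ℕP.≡ᵇ⇒≡ _ _ (resolve (atMostTwo t) t≤2 (checkPoints-sound check _ k t))
    where
    check : Fin 4 → Trace → Bool
    check k t = not (atMostTwo t) ∨
      (𝟙 (lookup t k) ≡ᵇ 𝟙 (does (pointTrace k ≟ₜ t)) + count (λ l → not (does (l ≟ k)) ∧ does (pairTrace k l ≟ₜ t)))
    resolve : ∀ a → T a → ∀ {e} → T (not a ∨ e) → T e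
    resolve true _ h = h

  other : Fin 4 → Fin 4
  other zero    = suc zero
  other (suc _) = zero

  ≢other : ∀ k → k ≢ other k
  ≢other zero    ()
  ≢other (suc k) ()

  count-≢ : ∀ (k : Fin 4) → count (λ l → not (does (l ≟ k))) ≡ 3
  count-≢ zero                   = refl
  count-≢ (suc zero)             = refl
  count-≢ (suc (suc zero))       = refl
  count-≢ (suc (suc (suc zero))) = refl

  module KindCounting {v : ℕ} (D : SQS v) (i : Fin (SQS.b D)) (x : Fin 4 → Fin v)
           (x∈B : ∀ k → x k ∈ SQS.block D i) (x-injective : ∀ {k l} → x k ≡ x l → k ≡ l) where
    open SQS D
    open Players D i x

    kindCount : Trace → ℕ
    kindCount w = count (λ j → does (just w ≟ₖ kind j))

    mem-B : ∀ k → mem D i (x k) ≡ true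
    mem-B k = dec-true (x k ∈? block i) (x∈B k)

    no-triple : ∀ {j} → j ≢ i → ∀ {k l m} → k ≢ l → k ≢ m → l ≢ m →
                (mem D j (x k) ∧ mem D j (x l) ∧ mem D j (x m)) ≡ false
    no-triple {j} j≢i {k} {l} {m} k≢l k≢m l≢m with mem D j (x k) ∧ mem D j (x l) ∧ mem D j (x m) in jklm
    ... | false = refl
    ... | true  = ⊥-elim (ℕP.<⇒≢ (count-two (λ j → mem D j (x k) ∧ mem D j (x l) ∧ mem D j (x m)) j≢i
                             (subst T (sym jklm) _) iklm)
                           (sym (count-through₃ D (k≢l ∘ x-injective) (k≢m ∘ x-injective) (l≢m ∘ x-injective))))
      where
      iklm : T (mem D i (x k) ∧ mem D i (x l) ∧ mem D i (x m))
      iklm rewrite mem-B k | mem-B l | mem-B m = _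

    trace-atMostTwo : ∀ {j} → j ≢ i → T (atMostTwo (trace j))
    trace-atMostTwo j≢i
      rewrite no-triple j≢i {zero} {suc zero} {suc (suc zero)} (λ ()) (λ ()) (λ ())
            | no-triple j≢i {zero} {suc zero} {suc (suc (suc zero))} (λ ()) (λ ()) (λ ())
            | no-triple j≢i {zero} {suc (suc zero)} {suc (suc (suc zero))} (λ ()) (λ ()) (λ ())
            | no-triple j≢i {suc zero} {suc (suc zero)} {suc (suc (suc zero))} (λ ()) (λ ()) (λ ()) = _

    lookup-trace : ∀ j k → lookup (trace j) k ≡ mem D j (x k)
    lookup-trace j k = VecP.lookup∘tabulate (λ k → mem D j (x k)) k

    pair-split : ∀ {k l} → k ≢ l → ∀ j →
      𝟙 (mem D j (x k) ∧ mem D j (x l)) ≡ 𝟙 (does (just (pairTrace k l) ≟ₖ kind j)) + 𝟙 (does (j ≟ i))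
    pair-split {k} {l} k≢l j with j ≟ i
    ... | yes j≡i rewrite j≡i | mem-B k | mem-B l = refl
    ... | no j≢i = begin
      𝟙 (mem D j (x k) ∧ mem D j (x l))
        ≡⟨ cong 𝟙 (sym (cong₂ _∧_ (lookup-trace j k) (lookup-trace j l))) ⟩
      𝟙 (lookup (trace j) k ∧ lookup (trace j) l)
        ≡⟨ pair-trace k≢l (trace j) (trace-atMostTwo j≢i) ⟩
      𝟙 (does (pairTrace k l ≟ₜ trace j))
        ≡⟨ ℕP.+-identityʳ _ ⟨
      𝟙 (does (pairTrace k l ≟ₜ trace j)) + 0 ∎
      where open ≡-Reasoning

    point-split : ∀ k j →
      𝟙 (mem D j (x k)) ≡ 𝟙 (does (just (pointTrace k) ≟ₖ kind j))
                          + count (λ l → not (does (l ≟ k)) ∧ does (just (pairTrace k l) ≟ₖ kind j))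
                          + 𝟙 (does (j ≟ i))
    point-split k j with j ≟ i
    ... | yes j≡i rewrite j≡i | mem-B k =
      cong (ℕ._+ 1) (sym (trans (count-cong (λ l → BoolP.∧-zeroʳ (not (does (l ≟ k))))) (count-false 4)))
    ... | no j≢i = begin
      𝟙 (mem D j (x k))
        ≡⟨ cong 𝟙 (sym (lookup-trace j k)) ⟩
      𝟙 (lookup (trace j) k)
        ≡⟨ point-trace k (trace j) (trace-atMostTwo j≢i) ⟩
      𝟙 (does (pointTrace k ≟ₜ trace j)) + count (λ l → not (does (l ≟ k)) ∧ does (pairTrace k l ≟ₜ trace j))
        ≡⟨ ℕP.+-identityʳ _ ⟨
      𝟙 (does (pointTrace k ≟ₜ trace j)) + count (λ l → not (does (l ≟ k)) ∧ does (pairTrace k l ≟ₜ trace j)) + 0 ∎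
      where open ≡-Reasoning

    through-pair : ∀ {k l} → k ≢ l → through₂ D (x k) (x l) ≡ kindCount (pairTrace k l) + 1
    through-pair {k} {l} k≢l = begin
      through₂ D (x k) (x l)
        ≡⟨ sum-cong-≗ (pair-split k≢l) ⟩
      sum (λ j → 𝟙 (does (just (pairTrace k l) ≟ₖ kind j)) + 𝟙 (does (j ≟ i)))
        ≡⟨ ∑-distrib-+ (λ j → 𝟙 (does (just (pairTrace k l) ≟ₖ kind j))) (λ j → 𝟙 (does (j ≟ i))) ⟩
      kindCount (pairTrace k l) + count (λ j → does (j ≟ i))
        ≡⟨ cong (kindCount (pairTrace k l) +_) (count-≟ i) ⟩
      kindCount (pairTrace k l) + 1 ∎
      where open ≡-Reasoning

    through-point : ∀ k → through₁ D (x k) ≡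
      kindCount (pointTrace k) + sum (λ l → 𝟙 (not (does (l ≟ k))) * kindCount (pairTrace k l)) + 1
    through-point k = begin
      through₁ D (x k)
        ≡⟨ sum-cong-≗ (point-split k) ⟩
      sum (λ j → 𝟙 (point j) + sum (λ l → pair l j) + 𝟙 (does (j ≟ i)))
        ≡⟨ ∑-distrib-+ (λ j → 𝟙 (point j) + sum (λ l → pair l j)) (λ j → 𝟙 (does (j ≟ i))) ⟩
      sum (λ j → 𝟙 (point j) + sum (λ l → pair l j)) + count (λ j → does (j ≟ i))
        ≡⟨ cong₂ _+_ (∑-distrib-+ (λ j → 𝟙 (point j)) (λ j → sum (λ l → pair l j))) (count-≟ i) ⟩
      kindCount (pointTrace k) + sum (λ j → sum (λ l → pair l j)) + 1
        ≡⟨ cong (λ s → kindCount (pointTrace k) + s + 1) (∑-comm (λ j l → pair l j)) ⟩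
      kindCount (pointTrace k) + sum (λ l → sum (pair l)) + 1
        ≡⟨ cong (λ s → kindCount (pointTrace k) + s + 1) (sum-cong-≗ factor) ⟩
      kindCount (pointTrace k) + sum (λ l → 𝟙 (not (does (l ≟ k))) * kindCount (pairTrace k l)) + 1 ∎
      where
      open ≡-Reasoning
      point : Fin b → Bool
      point j = does (just (pointTrace k) ≟ₖ kind j)
      pair : Fin 4 → Fin b → ℕ
      pair l j = 𝟙 (not (does (l ≟ k)) ∧ does (just (pairTrace k l) ≟ₖ kind j))
      factor : ∀ l → sum (pair l) ≡ 𝟙 (not (does (l ≟ k))) * kindCount (pairTrace k l)
      factor l = trans (sum-cong-≗ (λ j → 𝟙-∧ (not (does (l ≟ k))) (does (just (pairTrace k l) ≟ₖ kind j))))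
                       (sym (*-distribˡ-sum (𝟙 (not (does (l ≟ k)))) (λ j → 𝟙 (does (just (pairTrace k l) ≟ₖ kind j)))))

    pairs-around : ∀ k → sum (λ l → 𝟙 (not (does (l ≟ k))) * kindCount (pairTrace k l)) + 3
                       ≡ 3 * through₂ D (x k) (x (other k))
    pairs-around k = begin
      S + 3                                         ≡⟨ cong (S +_) (count-≢ k) ⟨
      S + count (λ l → not (does (l ≟ k)))
        ≡⟨ ∑-distrib-+ (λ l → 𝟙 (not (does (l ≟ k))) * kindCount (pairTrace k l)) (λ l → 𝟙 (not (does (l ≟ k)))) ⟨
      sum (λ l → 𝟙 (not (does (l ≟ k))) * kindCount (pairTrace k l) + 𝟙 (not (does (l ≟ k))))
                                                    ≡⟨ sum-cong-≗ step ⟩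
      sum (λ l → A * 𝟙 (not (does (l ≟ k))))        ≡⟨ *-distribˡ-sum A (λ l → 𝟙 (not (does (l ≟ k)))) ⟨
      A * count (λ l → not (does (l ≟ k)))          ≡⟨ cong (A *_) (count-≢ k) ⟩
      A * 3                                         ≡⟨ ℕP.*-comm A 3 ⟩
      3 * A ∎
      where
      open ≡-Reasoning
      A = through₂ D (x k) (x (other k))
      S = sum (λ l → 𝟙 (not (does (l ≟ k))) * kindCount (pairTrace k l))
      step : ∀ l → 𝟙 (not (does (l ≟ k))) * kindCount (pairTrace k l) + 𝟙 (not (does (l ≟ k))) ≡ A * 𝟙 (not (does (l ≟ k)))
      step l with l ≟ k
      ... | yes _  = sym (ℕP.*-zeroʳ A)
      ... | no l≢k = begin
        kindCount (pairTrace k l) + 0 + 1   ≡⟨ cong (_+ 1) (ℕP.+-identityʳ _) ⟩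
        kindCount (pairTrace k l) + 1       ≡⟨ through-pair (l≢k ∘ sym) ⟨
        through₂ D (x k) (x l)              ≡⟨ through₂-constant D ((l≢k ∘ sym) ∘ x-injective) (≢other k ∘ x-injective) ⟩
        A                                   ≡⟨ ℕP.*-identityʳ A ⟨
        A * 1 ∎

    heavyCount : ∀ w → ¬ T (atMostTwo w) → kindCount w ≡ 0
    heavyCount w heavy = trans (count-cong never) (count-false b)
      where
      never : ∀ j → does (just w ≟ₖ kind j) ≡ false
      never j with j ≟ i
      ... | yes _  = refl
      ... | no j≢i = dec-false (w ≟ₜ trace j) (λ w≡t → heavy (subst (T ∘ atMostTwo) (sym w≡t) (trace-atMostTwo j≢i)))

open KindCounts

module Evaluation where
  open import Data.Rational using (_+_; _*_; _-_)
  open ℚS using (Polynomial; ⟦_⟧; prove; solve; var; con; _:+_; _:*_; _:-_; _:=_)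

  module _ {v : ℕ} (D : SQS v) (i : Fin (SQS.b D)) (x : Fin 4 → Fin v)
           (x∈B : ∀ k → x k ∈ SQS.block D i) (x-injective : ∀ {k l} → x k ≡ x l → k ≡ l) where
    open KindCounting D i x x∈B x-injective

    r₂≡through₂ : ∀ {k l} → k ≢ l → r₂ v ≡ ℕtoℚ (through₂ D (x k) (x l))
    r₂≡through₂ {k} {l} k≢l = r₂≡ (through₂ D (x k) (x l)) (through₂-degree D (k≢l ∘ x-injective))

    r₁≡through₁ : ∀ k → r₁ v ≡ ℕtoℚ (through₁ D (x k))
    r₁≡through₁ k = r₁≡ (through₂ D (x k) (x (other k))) (through₁ D (x k)) (through₂-degree D xk≢) (through₁-degree D xk≢)
      where xk≢ = ≢other k ∘ x-injective

    pairCount : ∀ {k l} → k ≢ l → ℕtoℚ (kindCount (pairTrace k l)) ≡ r₂ v - 1ℚ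
    pairCount {k} {l} k≢l = begin
      c                          ≡⟨ solve 1 (λ c → c := c :+ con 1ℚ :- con 1ℚ) refl c ⟩
      c + 1ℚ - 1ℚ                ≡⟨ cong (_- 1ℚ) (ℕtoℚ-+ (kindCount (pairTrace k l)) 1) ⟨
      ℕtoℚ (kindCount (pairTrace k l) ℕ.+ 1) - 1ℚ
        ≡⟨ cong (λ n → ℕtoℚ n - 1ℚ) (through-pair k≢l) ⟨
      ℕtoℚ (through₂ D (x k) (x l)) - 1ℚ
        ≡⟨ cong (_- 1ℚ) (r₂≡through₂ k≢l) ⟨
      r₂ v - 1ℚ ∎
      where
      open ≡-Reasoning
      c = ℕtoℚ (kindCount (pairTrace k l))

    pointCount : ∀ k → ℕtoℚ (kindCount (pointTrace k)) ≡ r₁ v - ℕtoℚ 3 * r₂ v + ℕtoℚ 2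
    pointCount k = begin
      c                                         ≡⟨ solve 2 (λ c s → c := c :+ s :+ con 1ℚ :- (s :+ con (ℕtoℚ 3)) :+ con (ℕtoℚ 2)) refl c s ⟩
      c + s + 1ℚ - (s + ℕtoℚ 3) + ℕtoℚ 2       ≡⟨ cong₂ (λ a d → a - d + ℕtoℚ 2) point-sum pair-sum ⟩
      r₁ v - (r₂ v + (r₂ v + (r₂ v + 0ℚ))) + ℕtoℚ 2
        ≡⟨ cong (λ t → r₁ v - t + ℕtoℚ 2) (solve 1 (λ r → r :+ (r :+ (r :+ con 0ℚ)) := con (ℕtoℚ 3) :* r) refl (r₂ v)) ⟩
      r₁ v - ℕtoℚ 3 * r₂ v + ℕtoℚ 2 ∎
      where
      open ≡-Reasoning
      A = through₂ D (x k) (x (other k))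
      S = sum (λ l → 𝟙 (not (does (l ≟ k))) ℕ.* kindCount (pairTrace k l))
      c = ℕtoℚ (kindCount (pointTrace k))
      s = ℕtoℚ S
      point-sum : c + s + 1ℚ ≡ r₁ v
      point-sum = begin
        c + s + 1ℚ                                    ≡⟨ cong (_+ 1ℚ) (ℕtoℚ-+ (kindCount (pointTrace k)) S) ⟨
        ℕtoℚ (kindCount (pointTrace k) ℕ.+ S) + 1ℚ      ≡⟨ ℕtoℚ-+ (kindCount (pointTrace k) ℕ.+ S) 1 ⟨
        ℕtoℚ (kindCount (pointTrace k) ℕ.+ S ℕ.+ 1)       ≡⟨ cong ℕtoℚ (through-point k) ⟨
        ℕtoℚ (through₁ D (x k))                       ≡⟨ r₁≡through₁ k ⟨
        r₁ v ∎
      pair-sum : s + ℕtoℚ 3 ≡ r₂ v + (r₂ v + (r₂ v + 0ℚ))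
      pair-sum = begin
        s + ℕtoℚ 3                                    ≡⟨ ℕtoℚ-+ S 3 ⟨
        ℕtoℚ (S ℕ.+ 3)                                ≡⟨ cong ℕtoℚ (pairs-around k) ⟩
        ℕtoℚ (3 ℕ.* A)                                ≡⟨ trans (ℕtoℚ-+ A _) (cong (ℕtoℚ A +_) (trans (ℕtoℚ-+ A _) (cong (ℕtoℚ A +_) (ℕtoℚ-+ A 0)))) ⟩
        ℕtoℚ A + (ℕtoℚ A + (ℕtoℚ A + 0ℚ))             ≡⟨ cong (λ a → a + (a + (a + 0ℚ))) (r₂≡through₂ (≢other k)) ⟨
        r₂ v + (r₂ v + (r₂ v + 0ℚ)) ∎

  allKinds : List Kind
  allKinds = nothing ∷ map just (allSubsets 4)

  allKinds-complete : ∀ s → s ∈ₗ allKinds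
  allKinds-complete nothing  = here refl
  allKinds-complete (just w) = there (∈-map⁺ just (∈-allSubsets w))

  allKinds-unique : Unique allKinds
  allKinds-unique = toWitness {a? = UniqueDec.unique? _≟ₖ_ allKinds} _

  R₁ R₂ P : Polynomial 3
  R₁ = var zero
  R₂ = var (suc zero)
  P  = var (suc (suc zero))

  -- The weight of a kind is its number of players times p, as a polynomial in r₁, r₂ and p.
  weightPoly : Kind → Polynomial 3
  weightPoly nothing = con 0ℚ
  weightPoly (just w) with ∣ w ∣
  ... | 1 = (R₁ :- con (ℕtoℚ 3) :* R₂ :+ con (ℕtoℚ 2)) :* P
  ... | 2 = (R₂ :- con 1ℚ) :* P
  ... | _ = con 0ℚ

  -- sublistSum of coverIndicator, skipping the branches whose chosen kinds are already redundant, since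
  -- they contribute nothing; this keeps the polynomial small enough to normalise.
  prunedPoly : List Kind → List Kind → Polynomial 3
  prunedPoly []       ρ = if minimalCover ρ then con 1ℚ else con 0ℚ
  prunedPoly (s ∷ ts) ρ =
    if irredundant (ρ ++ [ s ]) then prunedPoly ts ρ :+ weightPoly s :* prunedPoly ts (ρ ++ [ s ]) else prunedPoly ts ρ

  _^P_ : Polynomial 3 → ℕ → Polynomial 3
  q ^P zero  = con 1ℚ
  q ^P suc n = q :* (q ^P n)

  formulaPoly : Polynomial 3
  formulaPoly =
    con (ℕtoℚ 3) :* ((R₂ :- con 1ℚ) ^P 2) :* (P ^P 2)
    :+ con (ℕtoℚ 2) :* (R₂ :- con 1ℚ)
        :* (con (ℕtoℚ 3) :* (R₁ ^P 2) :- con (ℕtoℚ 12) :* R₁ :* R₂ :+ con (ℕtoℚ 6) :* R₁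
           :+ con (ℕtoℚ 11) :* (R₂ ^P 2) :- con (ℕtoℚ 10) :* R₂ :+ con (ℕtoℚ 2))
        :* (P ^P 3)
    :+ ((R₁ :- con (ℕtoℚ 3) :* R₂ :+ con (ℕtoℚ 2)) ^P 4) :* (P ^P 4)

  formula≡⟦formulaPoly⟧ : ∀ v p → formula v p ≡ ⟦ formulaPoly ⟧ (r₁ v ∷ r₂ v ∷ p ∷ [])
  formula≡⟦formulaPoly⟧ v p = refl

  prunedPoly≡formulaPoly : ∀ env → ⟦ prunedPoly allKinds [] ⟧ env ≡ ⟦ formulaPoly ⟧ env
  prunedPoly≡formulaPoly env = prove env (prunedPoly allKinds []) formulaPoly refl

  ⟦prunedPoly⟧ : ∀ env ts ρ → ⟦ prunedPoly ts ρ ⟧ env ≡ sublistSum coverIndicator (λ s → ⟦ weightPoly s ⟧ env) ts ρ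
  ⟦prunedPoly⟧ env []       ρ with minimalCover ρ
  ... | true  = refl
  ... | false = refl
  ⟦prunedPoly⟧ env (s ∷ ts) ρ with irredundant (ρ ++ [ s ]) in irr
  ... | true  = cong₂ (λ a c → a + ⟦ weightPoly s ⟧ env * c) (⟦prunedPoly⟧ env ts ρ) (⟦prunedPoly⟧ env ts (ρ ++ [ s ]))
  ... | false = sym (begin
    sublistSum coverIndicator w ts ρ + w s * sublistSum coverIndicator w ts (ρ ++ [ s ])
      ≡⟨ cong (λ c → sublistSum coverIndicator w ts ρ + w s * c) pruned ⟩
    sublistSum coverIndicator w ts ρ + w s * 0ℚ
      ≡⟨ trans (cong (sublistSum coverIndicator w ts ρ +_) (ℚP.*-zeroʳ (w s))) (ℚP.+-identityʳ _) ⟩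
    sublistSum coverIndicator w ts ρ
      ≡⟨ ⟦prunedPoly⟧ env ts ρ ⟨
    ⟦ prunedPoly ts ρ ⟧ env ∎)
    where
    open ≡-Reasoning
    w = λ s → ⟦ weightPoly s ⟧ env
    pruned : sublistSum coverIndicator w ts (ρ ++ [ s ]) ≡ 0ℚ
    pruned = sublistSum-vanish coverIndicator w ts (ρ ++ [ s ]) (coverIndicator-prune (ρ ++ [ s ]) (λ h → subst T irr h))

open Evaluation

open import Data.Rational using (_+_; _*_; _-_; _≤_)
open ℚS using (⟦_⟧)

enumerate : ∀ {n} (S : Subset n) → Fin ∣ S ∣ → Fin n
enumerate (true  ∷ S) zero    = zero
enumerate (true  ∷ S) (suc k) = suc (enumerate S k)
enumerate (false ∷ S) k       = suc (enumerate S k)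

enumerate-∈ : ∀ {n} (S : Subset n) k → enumerate S k ∈ S
enumerate-∈ (true  ∷ S) zero    = Vec.here
enumerate-∈ (true  ∷ S) (suc k) = Vec.there (enumerate-∈ S k)
enumerate-∈ (false ∷ S) k       = Vec.there (enumerate-∈ S k)

enumerate-onto : ∀ {n} (S : Subset n) z → z ∈ S → Σ (Fin ∣ S ∣) λ k → enumerate S k ≡ z
enumerate-onto (true  ∷ S) zero    Vec.here      = zero , refl
enumerate-onto (true  ∷ S) (suc z) (Vec.there z∈S) with enumerate-onto S z z∈S
... | k , refl = suc k , refl
enumerate-onto (false ∷ S) (suc z) (Vec.there z∈S) with enumerate-onto S z z∈S
... | k , refl = k , refl

enumerate-injective : ∀ {n} (S : Subset n) {k l} → enumerate S k ≡ enumerate S l → k ≡ l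
enumerate-injective (true  ∷ S) {zero}  {zero}  _  = refl
enumerate-injective (true  ∷ S) {suc k} {suc l} eq = cong suc (enumerate-injective S (FinP.suc-injective eq))
enumerate-injective (false ∷ S)                 eq = enumerate-injective S (FinP.suc-injective eq)

Enumeration : ∀ {n} → Subset n → ℕ → Set
Enumeration {n} S m = Σ (Fin m → Fin n) λ x →
  (∀ k → x k ∈ S) × (∀ z → z ∈ S → Σ (Fin m) λ k → x k ≡ z) × (∀ {k l} → x k ≡ x l → k ≡ l)

enumeration : ∀ {n} (S : Subset n) {m} → ∣ S ∣ ≡ m → Enumeration S m
enumeration S refl = enumerate S , enumerate-∈ S , enumerate-onto S , enumerate-injective S

multiplicity-map : ∀ {T : Set} (_≟_ : DecidableEquality T) {n} (τ : Fin n → T) s →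
  multiplicity _≟_ (map τ (allFin n)) s ≡ count (λ j → does (s ≟ τ j))
multiplicity-map _≟_ {zero}  τ s = refl
multiplicity-map _≟_ {suc n} τ s = begin
  multiplicity _≟_ (map τ (allFin (suc n))) s
    ≡⟨ cong (λ L → multiplicity _≟_ L s) (map-allFin-suc τ) ⟩
  multiplicity _≟_ (τ zero ∷ map (τ ∘ suc) (allFin n)) s
    ≡⟨ peel (does (s ≟ τ zero)) (multiplicity-map _≟_ (τ ∘ suc) s) ⟩
  count (λ j → does (s ≟ τ j)) ∎
  where
  open ≡-Reasoning
  peel : ∀ d {m c} → m ≡ c → (if d then suc m else m) ≡ 𝟙 d ℕ.+ c
  peel true  refl = refl
  peel false refl = refl

module _ {v : ℕ} (D : SQS v) (i : Fin (SQS.b D)) (p : ℚ) (x : Fin 4 → Fin v)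
         (x∈B : ∀ k → x k ∈ SQS.block D i) (x-onto : ∀ z → z ∈ SQS.block D i → Σ (Fin 4) λ k → x k ≡ z)
         (x-injective : ∀ {k l} → x k ≡ x l → k ≡ l) where
  open SQS D
  open Players D i x
  open KindCounting D i x x∈B x-injective

  env : Vec ℚ 3
  env = r₁ v ∷ r₂ v ∷ p ∷ []

  kinds : List Kind
  kinds = map kind (allFin b)

  kindCount≡multiplicity : ∀ w → multiplicity _≟ₖ_ kinds (just w) ≡ kindCount w
  kindCount≡multiplicity w = multiplicity-map _≟ₖ_ kind (just w)

  weight-point : ∀ k → ℕtoℚ (multiplicity _≟ₖ_ kinds (just (pointTrace k))) * p ≡ (r₁ v - ℕtoℚ 3 * r₂ v + ℕtoℚ 2) * p
  weight-point k = cong (_* p) (trans (cong ℕtoℚ (kindCount≡multiplicity _)) (pointCount D i x x∈B x-injective k))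

  weight-pair : ∀ {k l} → k ≢ l → ℕtoℚ (multiplicity _≟ₖ_ kinds (just (pairTrace k l))) * p ≡ (r₂ v - 1ℚ) * p
  weight-pair k≢l = cong (_* p) (trans (cong ℕtoℚ (kindCount≡multiplicity _)) (pairCount D i x x∈B x-injective k≢l))

  weight-heavy : ∀ w → ¬ T (atMostTwo w) → ℕtoℚ (multiplicity _≟ₖ_ kinds (just w)) * p ≡ 0ℚ
  weight-heavy w heavy = trans (cong (λ n → ℕtoℚ n * p) (trans (kindCount≡multiplicity w) (heavyCount w heavy))) (ℚP.*-zeroˡ p)

  kind-weight : ∀ s → ℕtoℚ (multiplicity _≟ₖ_ kinds s) * p ≡ ⟦ weightPoly s ⟧ env
                      ⊎ (∀ α γ → coverIndicator (α ++ s ∷ γ) ≡ 0ℚ)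
  kind-weight nothing = inj₂ (coverIndicator-uncovering nothing λ _ → refl)
  kind-weight (just (false ∷ false ∷ false ∷ false ∷ [])) =
    inj₂ (coverIndicator-uncovering _ λ { 0F → refl ; 1F → refl ; 2F → refl ; 3F → refl })
  kind-weight (just (true  ∷ false ∷ false ∷ false ∷ [])) = inj₁ (weight-point 0F)
  kind-weight (just (false ∷ true  ∷ false ∷ false ∷ [])) = inj₁ (weight-point 1F)
  kind-weight (just (false ∷ false ∷ true  ∷ false ∷ [])) = inj₁ (weight-point 2F)
  kind-weight (just (false ∷ false ∷ false ∷ true  ∷ [])) = inj₁ (weight-point 3F)
  kind-weight (just (true  ∷ true  ∷ false ∷ false ∷ [])) = inj₁ (weight-pair {0F} {1F} λ ())
  kind-weight (just (true  ∷ false ∷ true  ∷ false ∷ [])) = inj₁ (weight-pair {0F} {2F} λ ())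
  kind-weight (just (true  ∷ false ∷ false ∷ true  ∷ [])) = inj₁ (weight-pair {0F} {3F} λ ())
  kind-weight (just (false ∷ true  ∷ true  ∷ false ∷ [])) = inj₁ (weight-pair {1F} {2F} λ ())
  kind-weight (just (false ∷ true  ∷ false ∷ true  ∷ [])) = inj₁ (weight-pair {1F} {3F} λ ())
  kind-weight (just (false ∷ false ∷ true  ∷ true  ∷ [])) = inj₁ (weight-pair {2F} {3F} λ ())
  kind-weight (just (true  ∷ true  ∷ true  ∷ false ∷ [])) = inj₁ (weight-heavy _ λ ())
  kind-weight (just (true  ∷ true  ∷ false ∷ true  ∷ [])) = inj₁ (weight-heavy _ λ ())
  kind-weight (just (true  ∷ false ∷ true  ∷ true  ∷ [])) = inj₁ (weight-heavy _ λ ())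
  kind-weight (just (false ∷ true  ∷ true  ∷ true  ∷ [])) = inj₁ (weight-heavy _ λ ())
  kind-weight (just (true  ∷ true  ∷ true  ∷ true  ∷ [])) = inj₁ (weight-heavy _ λ ())

  multiplicities≡weightPoly : ∀ ts ρ →
    sublistSum coverIndicator (λ s → ℕtoℚ (multiplicity _≟ₖ_ kinds s) * p) ts ρ
      ≡ sublistSum coverIndicator (λ s → ⟦ weightPoly s ⟧ env) ts ρ
  multiplicities≡weightPoly ts ρ = sublistSum-cong-weight coverIndicator _ _ ts ρ (λ s _ → kind-weight s)

  sublistSum≡prunedPoly : sublistSum coverIndicator (λ _ → p) kinds [] ≡ ⟦ prunedPoly allKinds [] ⟧ env
  sublistSum≡prunedPoly =
    trans (sublistSum-group coverIndicator coverIndicator-swap coverIndicator-repeats _≟ₖ_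
             allKinds allKinds-unique allKinds-complete p kinds [])
      (trans (multiplicities≡weightPoly allKinds []) (sym (⟦prunedPoly⟧ env allKinds [])))

  E≡formula : E D i p ≡ formula v p
  E≡formula = begin
    E D i p
      ≡⟨ E≡sum-minimal D i p ⟩
    sumℚ (map (λ R → indicator (isMinimalRepairSet? D i R) * p ^∣ R ∣) (allSubsets b))
      ≡⟨ cong sumℚ (ListP.map-cong (λ R → cong (_* p ^∣ R ∣) (minimalIndicator≡coverIndicator x∈B x-onto R)) (allSubsets b)) ⟩
    sumℚ (map (λ R → coverIndicator (select kind R) * p ^∣ R ∣) (allSubsets b))
      ≡⟨ sum-subsets≡sublistSum coverIndicator p b kind [] ⟩
    sublistSum coverIndicator (λ _ → p) kinds []
      ≡⟨ sublistSum≡prunedPoly ⟩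
    ⟦ prunedPoly allKinds [] ⟧ env
      ≡⟨ prunedPoly≡formulaPoly env ⟩
    ⟦ formulaPoly ⟧ env
      ≡⟨ formula≡⟦formulaPoly⟧ v p ⟨
    formula v p ∎
    where open ≡-Reasoning

theorem3p8 : (v : ℕ) (D : SQS v) (i : Fin (SQS.b D)) (p : ℚ) →
    0ℚ ≤ p → p ≤ 1ℚ →
    E D i p ≡ formula v p
theorem3p8 v D i p _ _ with enumeration (SQS.block D i) (SQS.blockSize D i)
... | x , x∈B , x-onto , x-injective = E≡formula D i p x x∈B x-onto x-injective
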